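{- Let $b\ge1$ and let $\lambda=(\lambda_1\ge\cdots\ge\lambda_b)$ be a partition with $b$ parts. Then, as formal power series in $q$, \[ G_{\lambda}(q)=\sum_{A\subseteq [b]}(-1)^{|A|}q^{\sum_{k=1}^{b} f^\lambda_A(k)}\prod_{k=1}^{b} \frac{1}{1-q^{g_A(k)}}. \]
   Context: $[b]=\{1,\dots,b\}$. For partitions $\mu,\lambda$, $\mu\subseteq\lambda$ means $\mu_j\le\lambda_j$ for all $j$ (missing parts being $0$). $G_\lambda(q)=\sum_{\mu\subseteq\lambda}q^{|\mu|}$, the sum over all partitions $\mu\subseteq\lambda$ including the empty one, where $|\mu|$ is the sum of parts. Convention: $\max(\emptyset)=1$. For $A\subseteq[b]$ and $1\le k\le b$: if $A\neq\emptyset$ and $k\ge\min(A)$, then $f^\lambda_A(k)=\lambda_{b+1-\max(A\cap[k])}+1$; otherwise $f^\lambda_A(k)=0$. Also $g_A(k)=k-\max(A\cap[k])+1$. Each $\frac{1}{1-q^m}$ is expanded as $\sum_{j\ge0}q^{mj}$. -}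

module Defs where

open import Data.Bool using (Bool; true; false; if_then_else_; _∧_; not)
open import Data.Nat as ℕ using (ℕ; zero; suc; _∸_; _≤ᵇ_; _≡ᵇ_)
open import Data.Integer as ℤ using (ℤ)
open import Data.List using (List; []; _∷_; map; foldr; upTo; filterᵇ; length; concatMap; null)
open import Data.Vec as Vec using (Vec; toList)
open import Data.Fin as Fin using (Fin)

-- Formal power series in q with integer coefficients, given by their
-- coefficient sequence:  f = Σ_n (f n) q^n.

PowerSeries : Set
PowerSeries = ℕ → ℤ

zeroPS : PowerSeries
zeroPS _ = ℤ.0ℤ

_⊕_ : PowerSeries → PowerSeries → PowerSeries
(f ⊕ g) n = f n ℤ.+ g n

_⊛_ : PowerSeries → PowerSeries → PowerSeries
(f ⊛ g) n = foldr ℤ._+_ ℤ.0ℤ (map (λ i → f i ℤ.* g (n ∸ i)) (upTo (suc n)))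

scale : ℤ → PowerSeries → PowerSeries
scale c f n = c ℤ.* f n

monomial : ℕ → PowerSeries
monomial m n = if m ≡ᵇ n then ℤ.1ℤ else ℤ.0ℤ

onePS : PowerSeries
onePS = monomial 0

-- 1/(1-q^m) expanded as Σ_{j≥0} q^{mj}: the coefficient of q^n is the
-- number of j ≥ 0 with m*j = n (for m ≥ 1 such j satisfies j ≤ n).
geometric : ℕ → PowerSeries
geometric m n = ℤ.+ length (filterᵇ (λ j → (m ℕ.* j) ≡ᵇ n) (upTo (suc n)))

ΣPS : List PowerSeries → PowerSeries
ΣPS = foldr _⊕_ zeroPS

ΠPS : List PowerSeries → PowerSeries
ΠPS = foldr _⊛_ onePS

range : ℕ → List ℕ
range b = map suc (upTo b)

-- 1-based lookup in a list, missing entries read as the default d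
nthD : {A : Set} → A → List A → ℕ → A
nthD d []       _             = d
nthD d (x ∷ xs) zero          = d
nthD d (x ∷ xs) (suc zero)    = x
nthD d (x ∷ xs) (suc (suc j)) = nthD d xs (suc j)

-- λ_j (1-based; missing parts are 0)
part : {b : ℕ} → Vec ℕ b → ℕ → ℕ
part la j = nthD 0 (toList la) j

IsPartition : {b : ℕ} → Vec ℕ b → Set
IsPartition {b} la =
  (∀ (i j : Fin b) → i Fin.≤ j → Vec.lookup la j ℕ.≤ Vec.lookup la i)
  × (∀ (i : Fin b) → 1 ℕ.≤ Vec.lookup la i)
  where open import Data.Product using (_×_)

-- subsets of [b], encoded as characteristic vectors (entry i ↔ element i+1)
allSubsets : (b : ℕ) → List (Vec Bool b)
allSubsets zero    = Vec.[] ∷ []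
allSubsets (suc b) = concatMap (λ v → (true Vec.∷ v) ∷ (false Vec.∷ v) ∷ []) (allSubsets b)

elems : {b : ℕ} → Vec Bool b → List ℕ
elems {b} A = filterᵇ (nthD false (toList A)) (range b)

card : {b : ℕ} → Vec Bool b → ℕ
card A = length (elems A)

capUpTo : {b : ℕ} → Vec Bool b → ℕ → List ℕ
capUpTo A k = filterᵇ (λ i → i ≤ᵇ k) (elems A)

-- max with the convention max(∅) = 1
maxC : List ℕ → ℕ
maxC []       = 1
maxC (x ∷ xs) = foldr ℕ._⊔_ x xs

minNE : ℕ → List ℕ → ℕ
minNE x xs = foldr ℕ._⊓_ x xs

fA : {b : ℕ} → Vec ℕ b → Vec Bool b → ℕ → ℕ
fA {b} la A k with elems A
... | []     = 0
... | x ∷ xs = if minNE x xs ≤ᵇ k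
                 then part la (suc b ∸ maxC (capUpTo A k)) ℕ.+ 1
                 else 0

gA : {b : ℕ} → Vec Bool b → ℕ → ℕ
gA A k = k ∸ maxC (capUpTo A k) ℕ.+ 1

sign : ℕ → ℤ
sign zero    = ℤ.1ℤ
sign (suc m) = ℤ.- sign m

RHS : {b : ℕ} → Vec ℕ b → PowerSeries
RHS {b} la = ΣPS (map term (allSubsets b))
  where
  term : Vec Bool b → PowerSeries
  term A = scale (sign (card A))
             (monomial (foldr ℕ._+_ 0 (map (fA la A) (range b)))
               ⊛ ΠPS (map (λ k → geometric (gA A k)) (range b)))

-- G_λ(q) = Σ_{μ ⊆ λ} q^{|μ|}.  A partition μ ⊆ λ has at most b parts, so it
-- is encoded (bijectively) as a weakly decreasing vector (μ_1,…,μ_b) of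
-- naturals, padded with zeros, with μ_j ≤ λ_j.

box : {b : ℕ} → Vec ℕ b → List (Vec ℕ b)
box Vec.[]         = Vec.[] ∷ []
box (l Vec.∷ la)   = concatMap (λ x → map (x Vec.∷_) (box la)) (upTo (suc l))

weaklyDecᵇ : List ℕ → Bool
weaklyDecᵇ []           = true
weaklyDecᵇ (x ∷ [])     = true
weaklyDecᵇ (x ∷ y ∷ xs) = (y ≤ᵇ x) ∧ weaklyDecᵇ (y ∷ xs)

subPartitions : {b : ℕ} → Vec ℕ b → List (Vec ℕ b)
subPartitions la = filterᵇ (λ mu → weaklyDecᵇ (toList mu)) (box la)

G : {b : ℕ} → Vec ℕ b → PowerSeries
G la = ΣPS (map (λ mu → monomial (Vec.sum mu)) (subPartitions la))

module Submission where

-- Both sides are embedded in families indexed by a shift d ≥ 0.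
--  * Left:  Gcap x μ  is the generating function of the partitions ν ⊆ μ with ν₁ ≤ x,
--    and Gshift d (l, μ) = Σ_{x ≤ l} q^{(d+1)x} Gcap x μ, so that Gshift 0 λ = G_λ.
--    Telescoping gives  (1 - q^{d+1}) Gshift d (l, μ) = Gshift (d+1) μ - q^{(d+1)(l+1)} Gcap l μ.
--  * Right: W d λ is the right-hand side with the range [b] of k replaced by [b+d],
--    and P d = Π_{k ≤ d} 1/(1-q^k).  Splitting the subsets of [b+1] according to
--    whether they contain b+1 gives  W d (l, μ) = W (d+1) μ - q^{(d+1)(l+1)} P (d+1) W 0 μ.
-- Since (1 - q^{d+1}) · 1/(1 - q^{d+1}) = 1, induction on λ shows W d λ = P d · Gshift d λ,
-- and d = 0 is the theorem.

open import Defs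
open import Data.Nat using (ℕ; _≤_)
open import Data.Vec using (Vec)
open import Relation.Binary.PropositionalEquality using (_≡_)

module FiniteSums where

  open import Data.Nat as ℕ using (ℕ; zero; suc; _∸_; z≤n; s≤s)
  import Data.Nat.Properties as NP
  open import Data.Integer using (ℤ; 0ℤ; _+_; _*_)
  import Data.Integer.Properties as ZP
  open import Data.List using (foldr; map; upTo; applyUpTo)
  open import Data.List.Properties using (map-upTo)
  open import Function using (_∘_)
  open import Relation.Binary.PropositionalEquality
  open import Relation.Nullary using (¬_)

  Σ : ℕ → (ℕ → ℤ) → ℤ
  Σ zero    F = 0ℤ
  Σ (suc n) F = F 0 + Σ n (F ∘ suc)

  foldr-upTo≡Σ : ∀ n (F : ℕ → ℤ) → foldr _+_ 0ℤ (map F (upTo n)) ≡ Σ n F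
  foldr-upTo≡Σ n F = trans (cong (foldr _+_ 0ℤ) (map-upTo F n)) (applyUpTo≡Σ n F)
    where
    applyUpTo≡Σ : ∀ n (F : ℕ → ℤ) → foldr _+_ 0ℤ (applyUpTo F n) ≡ Σ n F
    applyUpTo≡Σ zero    F = refl
    applyUpTo≡Σ (suc n) F = cong (F 0 +_) (applyUpTo≡Σ n (F ∘ suc))

  Σ-cong : ∀ n {F G : ℕ → ℤ} → (∀ i → i ℕ.< n → F i ≡ G i) → Σ n F ≡ Σ n G
  Σ-cong zero    h = refl
  Σ-cong (suc n) h = cong₂ _+_ (h 0 (s≤s z≤n)) (Σ-cong n (λ i i<n → h (suc i) (s≤s i<n)))

  Σ-ext : ∀ n {F G : ℕ → ℤ} → (∀ i → F i ≡ G i) → Σ n F ≡ Σ n G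
  Σ-ext n h = Σ-cong n (λ i _ → h i)

  Σ-snoc : ∀ n (F : ℕ → ℤ) → Σ (suc n) F ≡ Σ n F + F n
  Σ-snoc zero    F = trans (ZP.+-identityʳ (F 0)) (sym (ZP.+-identityˡ (F 0)))
  Σ-snoc (suc n) F = trans (cong (F 0 +_) (Σ-snoc n (F ∘ suc))) (sym (ZP.+-assoc (F 0) _ _))

  Σ-+ : ∀ n (F G : ℕ → ℤ) → Σ n (λ i → F i + G i) ≡ Σ n F + Σ n G
  Σ-+ zero    F G = refl
  Σ-+ (suc n) F G = begin
    F 0 + G 0 + Σ n (λ i → F (suc i) + G (suc i))  ≡⟨ cong (F 0 + G 0 +_) (Σ-+ n (F ∘ suc) (G ∘ suc)) ⟩
    F 0 + G 0 + (Σ n (F ∘ suc) + Σ n (G ∘ suc))    ≡⟨ ZP.+-assoc (F 0) (G 0) _ ⟩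
    F 0 + (G 0 + (Σ n (F ∘ suc) + Σ n (G ∘ suc)))  ≡⟨ cong (F 0 +_) (sym (ZP.+-assoc (G 0) _ _)) ⟩
    F 0 + (G 0 + Σ n (F ∘ suc) + Σ n (G ∘ suc))    ≡⟨ cong (λ x → F 0 + (x + Σ n (G ∘ suc))) (ZP.+-comm (G 0) _) ⟩
    F 0 + (Σ n (F ∘ suc) + G 0 + Σ n (G ∘ suc))    ≡⟨ cong (F 0 +_) (ZP.+-assoc (Σ n (F ∘ suc)) (G 0) _) ⟩
    F 0 + (Σ n (F ∘ suc) + (G 0 + Σ n (G ∘ suc)))  ≡⟨ sym (ZP.+-assoc (F 0) _ _) ⟩
    F 0 + Σ n (F ∘ suc) + (G 0 + Σ n (G ∘ suc))    ∎
    where open ≡-Reasoning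

  Σ-*ˡ : ∀ n c (F : ℕ → ℤ) → Σ n (λ i → c * F i) ≡ c * Σ n F
  Σ-*ˡ zero    c F = sym (ZP.*-zeroʳ c)
  Σ-*ˡ (suc n) c F = trans (cong (c * F 0 +_) (Σ-*ˡ n c (F ∘ suc))) (sym (ZP.*-distribˡ-+ c (F 0) _))

  Σ-*ʳ : ∀ n c (F : ℕ → ℤ) → Σ n (λ i → F i * c) ≡ Σ n F * c
  Σ-*ʳ n c F = trans (Σ-ext n (λ i → ZP.*-comm (F i) c)) (trans (Σ-*ˡ n c F) (ZP.*-comm c _))

  Σ-zero : ∀ n {F : ℕ → ℤ} → (∀ i → i ℕ.< n → F i ≡ 0ℤ) → Σ n F ≡ 0ℤ
  Σ-zero zero    h = refl
  Σ-zero (suc n) h = cong₂ _+_ (h 0 (s≤s z≤n)) (Σ-zero n (λ i i<n → h (suc i) (s≤s i<n)))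

  Σ-delta : ∀ n m {F : ℕ → ℤ} → m ℕ.< n → (∀ i → i ℕ.< n → ¬ i ≡ m → F i ≡ 0ℤ) → Σ n F ≡ F m
  Σ-delta (suc n) zero {F} _ h =
    trans (cong (F 0 +_) (Σ-zero n (λ i i<n → h (suc i) (s≤s i<n) (λ ())))) (ZP.+-identityʳ (F 0))
  Σ-delta (suc n) (suc m) (s≤s m<n) h =
    trans (cong₂ _+_ (h 0 (s≤s z≤n) (λ ()))
                     (Σ-delta n m m<n (λ i i<n i≢m → h (suc i) (s≤s i<n) (i≢m ∘ NP.suc-injective))))
          (ZP.+-identityˡ _)

  Σ-reverse : ∀ n (F : ℕ → ℤ) → Σ (suc n) F ≡ Σ (suc n) (λ i → F (n ∸ i))
  Σ-reverse zero    F = refl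
  Σ-reverse (suc n) F = begin
    F 0 + Σ (suc n) (F ∘ suc)                       ≡⟨ cong (F 0 +_) (Σ-reverse n (F ∘ suc)) ⟩
    F 0 + Σ (suc n) (λ i → F (suc (n ∸ i)))         ≡⟨ ZP.+-comm (F 0) _ ⟩
    Σ (suc n) (λ i → F (suc (n ∸ i))) + F 0         ≡⟨ cong₂ _+_ (Σ-cong (suc n) shift) (cong F (sym (NP.n∸n≡0 n))) ⟩
    Σ (suc n) (λ i → F (suc n ∸ i)) + F (n ∸ n)     ≡⟨ sym (Σ-snoc (suc n) (λ i → F (suc n ∸ i))) ⟩
    Σ (suc (suc n)) (λ i → F (suc n ∸ i))           ∎
    where
    open ≡-Reasoning
    shift : ∀ i → i ℕ.< suc n → F (suc (n ∸ i)) ≡ F (suc n ∸ i)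
    shift i i<n = cong F (sym (NP.+-∸-assoc 1 (NP.≤-pred i<n)))

  Σ-triangle : ∀ n (T : ℕ → ℕ → ℤ) →
    Σ (suc n) (λ i → Σ (suc i) (T i)) ≡ Σ (suc n) (λ j → Σ (suc (n ∸ j)) (λ k → T (j ℕ.+ k) j))
  Σ-triangle zero    T = refl
  Σ-triangle (suc n) T = begin
    Σ (suc (suc n)) (λ i → Σ (suc i) (T i))
      ≡⟨ Σ-snoc (suc n) (λ i → Σ (suc i) (T i)) ⟩
    Σ (suc n) (λ i → Σ (suc i) (T i)) + Σ (suc (suc n)) (T (suc n))
      ≡⟨ cong₂ _+_ (Σ-triangle n T) (Σ-snoc (suc n) (T (suc n))) ⟩
    Σ (suc n) Inner + (Σ (suc n) (T (suc n)) + T (suc n) (suc n))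
      ≡⟨ sym (ZP.+-assoc (Σ (suc n) Inner) _ _) ⟩
    Σ (suc n) Inner + Σ (suc n) (T (suc n)) + T (suc n) (suc n)
      ≡⟨ cong₂ _+_ (trans (sym (Σ-+ (suc n) Inner (T (suc n)))) (Σ-cong (suc n) extendInner)) lastInner ⟩
    Σ (suc n) Inner′ + Inner′ (suc n)
      ≡⟨ sym (Σ-snoc (suc n) Inner′) ⟩
    Σ (suc (suc n)) Inner′ ∎
    where
    open ≡-Reasoning
    Inner Inner′ : ℕ → ℤ
    Inner  j = Σ (suc (n ∸ j)) (λ k → T (j ℕ.+ k) j)
    Inner′ j = Σ (suc (suc n ∸ j)) (λ k → T (j ℕ.+ k) j)
    lastInner : T (suc n) (suc n) ≡ Inner′ (suc n)
    lastInner = begin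
      T (suc n) (suc n)                    ≡⟨ cong (λ x → T x (suc n)) (sym (NP.+-identityʳ (suc n))) ⟩
      T (suc n ℕ.+ 0) (suc n)              ≡⟨ sym (ZP.+-identityʳ _) ⟩
      Σ 1 (λ k → T (suc n ℕ.+ k) (suc n))
        ≡⟨ cong (λ m → Σ (suc m) (λ k → T (suc n ℕ.+ k) (suc n))) (sym (NP.n∸n≡0 n)) ⟩
      Inner′ (suc n)                       ∎
    extendInner : ∀ j → j ℕ.< suc n → Inner j + T (suc n) j ≡ Inner′ j
    extendInner j j<n = begin
      Inner j + T (suc n) j                        ≡⟨ cong (λ x → Inner j + T x j) (sym last) ⟩
      Inner j + T (j ℕ.+ suc (n ∸ j)) j            ≡⟨ sym (Σ-snoc (suc (n ∸ j)) (λ k → T (j ℕ.+ k) j)) ⟩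
      Σ (suc (suc (n ∸ j))) (λ k → T (j ℕ.+ k) j)
        ≡⟨ cong (λ m → Σ (suc m) (λ k → T (j ℕ.+ k) j)) (sym (NP.+-∸-assoc 1 (NP.≤-pred j<n))) ⟩
      Inner′ j                                     ∎
      where
      last : j ℕ.+ suc (n ∸ j) ≡ suc n
      last = trans (NP.+-suc j (n ∸ j)) (cong suc (NP.m+[n∸m]≡n (NP.≤-pred j<n)))

module PowerSeriesAlgebra where

  open FiniteSums
  open import Data.Bool using (true; false)
  open import Data.Nat as ℕ using (ℕ; zero; suc; _∸_; z≤n; s≤s; _≡ᵇ_)
  import Data.Nat.Properties as NP
  open import Data.Integer using (0ℤ; 1ℤ; _+_; _*_)
  import Data.Integer.Properties as ZP
  open import Function using (_∘_)
  open import Relation.Binary.PropositionalEquality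
  open import Relation.Nullary using (¬_; yes; no)
  open import Data.Empty using (⊥-elim)

  ≡ᵇ-refl : ∀ m → (m ≡ᵇ m) ≡ true
  ≡ᵇ-refl zero    = refl
  ≡ᵇ-refl (suc m) = ≡ᵇ-refl m

  ≡ᵇ-≢ : ∀ m n → ¬ m ≡ n → (m ≡ᵇ n) ≡ false
  ≡ᵇ-≢ zero    zero    h = ⊥-elim (h refl)
  ≡ᵇ-≢ zero    (suc n) h = refl
  ≡ᵇ-≢ (suc m) zero    h = refl
  ≡ᵇ-≢ (suc m) (suc n) h = ≡ᵇ-≢ m n (h ∘ cong suc)

  monomial-diag : ∀ m → monomial m m ≡ 1ℤ
  monomial-diag m rewrite ≡ᵇ-refl m = refl

  monomial-off : ∀ m n → ¬ m ≡ n → monomial m n ≡ 0ℤ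
  monomial-off m n h rewrite ≡ᵇ-≢ m n h = refl

  ⊛-coeff : ∀ f g n → (f ⊛ g) n ≡ Σ (suc n) (λ i → f i * g (n ∸ i))
  ⊛-coeff f g n = foldr-upTo≡Σ (suc n) (λ i → f i * g (n ∸ i))

  ⊛-cong : ∀ {f f′ g g′} → f ≗ f′ → g ≗ g′ → (f ⊛ g) ≗ (f′ ⊛ g′)
  ⊛-cong {f} {f′} {g} {g′} p q n =
    trans (⊛-coeff f g n) (trans (Σ-ext (suc n) (λ i → cong₂ _*_ (p i) (q (n ∸ i)))) (sym (⊛-coeff f′ g′ n)))

  ⊕-cong : ∀ {f f′ g g′} → f ≗ f′ → g ≗ g′ → (f ⊕ g) ≗ (f′ ⊕ g′)
  ⊕-cong p q n = cong₂ _+_ (p n) (q n)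

  ⊛-comm : ∀ f g → (f ⊛ g) ≗ (g ⊛ f)
  ⊛-comm f g n = begin
    (f ⊛ g) n                                      ≡⟨ ⊛-coeff f g n ⟩
    Σ (suc n) (λ i → f i * g (n ∸ i))              ≡⟨ Σ-reverse n (λ i → f i * g (n ∸ i)) ⟩
    Σ (suc n) (λ i → f (n ∸ i) * g (n ∸ (n ∸ i)))  ≡⟨ Σ-cong (suc n) swap ⟩
    Σ (suc n) (λ i → g i * f (n ∸ i))              ≡⟨ sym (⊛-coeff g f n) ⟩
    (g ⊛ f) n                                      ∎
    where
    open ≡-Reasoning
    swap : ∀ i → i ℕ.< suc n → f (n ∸ i) * g (n ∸ (n ∸ i)) ≡ g i * f (n ∸ i)
    swap i i<n = trans (cong (λ x → f (n ∸ i) * g x) (NP.m∸[m∸n]≡n (NP.≤-pred i<n))) (ZP.*-comm (f (n ∸ i)) (g i))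

  ⊛-assoc : ∀ f g h → ((f ⊛ g) ⊛ h) ≗ (f ⊛ (g ⊛ h))
  ⊛-assoc f g h n = begin
    ((f ⊛ g) ⊛ h) n
      ≡⟨ ⊛-coeff (f ⊛ g) h n ⟩
    Σ (suc n) (λ i → (f ⊛ g) i * h (n ∸ i))
      ≡⟨ Σ-ext (suc n) expandInner ⟩
    Σ (suc n) (λ i → Σ (suc i) (λ j → f j * g (i ∸ j) * h (n ∸ i)))
      ≡⟨ Σ-triangle n (λ i j → f j * g (i ∸ j) * h (n ∸ i)) ⟩
    Σ (suc n) (λ j → Σ (suc (n ∸ j)) (λ k → f j * g (j ℕ.+ k ∸ j) * h (n ∸ (j ℕ.+ k))))
      ≡⟨ Σ-ext (suc n) (λ j → Σ-ext (suc (n ∸ j)) (reindex j)) ⟩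
    Σ (suc n) (λ j → Σ (suc (n ∸ j)) (λ k → f j * (g k * h (n ∸ j ∸ k))))
      ≡⟨ Σ-ext (suc n) collapseInner ⟩
    Σ (suc n) (λ j → f j * (g ⊛ h) (n ∸ j))
      ≡⟨ sym (⊛-coeff f (g ⊛ h) n) ⟩
    (f ⊛ (g ⊛ h)) n ∎
    where
    open ≡-Reasoning
    expandInner : ∀ i → (f ⊛ g) i * h (n ∸ i) ≡ Σ (suc i) (λ j → f j * g (i ∸ j) * h (n ∸ i))
    expandInner i = trans (cong (_* h (n ∸ i)) (⊛-coeff f g i)) (sym (Σ-*ʳ (suc i) (h (n ∸ i)) (λ j → f j * g (i ∸ j))))
    collapseInner : ∀ j → Σ (suc (n ∸ j)) (λ k → f j * (g k * h (n ∸ j ∸ k))) ≡ f j * (g ⊛ h) (n ∸ j)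
    collapseInner j = trans (Σ-*ˡ (suc (n ∸ j)) (f j) (λ k → g k * h (n ∸ j ∸ k))) (cong (f j *_) (sym (⊛-coeff g h (n ∸ j))))
    reindex : ∀ j k → f j * g (j ℕ.+ k ∸ j) * h (n ∸ (j ℕ.+ k)) ≡ f j * (g k * h (n ∸ j ∸ k))
    reindex j k = trans (cong₂ (λ x y → f j * g x * h y) (NP.m+n∸m≡n j k) (sym (NP.∸-+-assoc n j k)))
                        (ZP.*-assoc (f j) (g k) (h (n ∸ j ∸ k)))

  ⊛-distribʳ : ∀ f g h → ((f ⊕ g) ⊛ h) ≗ ((f ⊛ h) ⊕ (g ⊛ h))
  ⊛-distribʳ f g h n = begin
    ((f ⊕ g) ⊛ h) n
      ≡⟨ ⊛-coeff (f ⊕ g) h n ⟩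
    Σ (suc n) (λ i → (f i + g i) * h (n ∸ i))
      ≡⟨ Σ-ext (suc n) (λ i → ZP.*-distribʳ-+ (h (n ∸ i)) (f i) (g i)) ⟩
    Σ (suc n) (λ i → f i * h (n ∸ i) + g i * h (n ∸ i))
      ≡⟨ Σ-+ (suc n) (λ i → f i * h (n ∸ i)) (λ i → g i * h (n ∸ i)) ⟩
    Σ (suc n) (λ i → f i * h (n ∸ i)) + Σ (suc n) (λ i → g i * h (n ∸ i))
      ≡⟨ sym (cong₂ _+_ (⊛-coeff f h n) (⊛-coeff g h n)) ⟩
    ((f ⊛ h) ⊕ (g ⊛ h)) n ∎
    where open ≡-Reasoning

  ⊛-distribˡ : ∀ f g h → (h ⊛ (f ⊕ g)) ≗ ((h ⊛ f) ⊕ (h ⊛ g))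
  ⊛-distribˡ f g h n =
    trans (⊛-comm h (f ⊕ g) n) (trans (⊛-distribʳ f g h n) (cong₂ _+_ (⊛-comm f h n) (⊛-comm g h n)))

  scale-⊛ : ∀ c f g → (scale c f ⊛ g) ≗ scale c (f ⊛ g)
  scale-⊛ c f g n = begin
    (scale c f ⊛ g) n                        ≡⟨ ⊛-coeff (scale c f) g n ⟩
    Σ (suc n) (λ i → c * f i * g (n ∸ i))    ≡⟨ Σ-ext (suc n) (λ i → ZP.*-assoc c (f i) (g (n ∸ i))) ⟩
    Σ (suc n) (λ i → c * (f i * g (n ∸ i)))  ≡⟨ Σ-*ˡ (suc n) c (λ i → f i * g (n ∸ i)) ⟩
    c * Σ (suc n) (λ i → f i * g (n ∸ i))    ≡⟨ cong (c *_) (sym (⊛-coeff f g n)) ⟩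
    scale c (f ⊛ g) n                        ∎
    where open ≡-Reasoning

  ⊛-scale : ∀ c f g → (f ⊛ scale c g) ≗ scale c (f ⊛ g)
  ⊛-scale c f g n = trans (⊛-comm f (scale c g) n) (trans (scale-⊛ c g f n) (cong (c *_) (⊛-comm g f n)))

  zero-⊛ : ∀ f → (zeroPS ⊛ f) ≗ zeroPS
  zero-⊛ f n = trans (⊛-coeff zeroPS f n) (Σ-zero (suc n) (λ i _ → ZP.*-zeroˡ (f (n ∸ i))))

  ⊛-zero : ∀ f → (f ⊛ zeroPS) ≗ zeroPS
  ⊛-zero f n = trans (⊛-comm f zeroPS n) (zero-⊛ f n)

  monomial-⊛-≤ : ∀ m f n → m ℕ.≤ n → (monomial m ⊛ f) n ≡ f (n ∸ m)
  monomial-⊛-≤ m f n m≤n = begin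
    (monomial m ⊛ f) n                          ≡⟨ ⊛-coeff (monomial m) f n ⟩
    Σ (suc n) (λ i → monomial m i * f (n ∸ i))  ≡⟨ Σ-delta (suc n) m (s≤s m≤n) offDiagonal ⟩
    monomial m m * f (n ∸ m)                    ≡⟨ cong (_* f (n ∸ m)) (monomial-diag m) ⟩
    1ℤ * f (n ∸ m)                              ≡⟨ ZP.*-identityˡ _ ⟩
    f (n ∸ m)                                   ∎
    where
    open ≡-Reasoning
    offDiagonal : ∀ i → i ℕ.< suc n → ¬ i ≡ m → monomial m i * f (n ∸ i) ≡ 0ℤ
    offDiagonal i _ i≢m = trans (cong (_* f (n ∸ i)) (monomial-off m i (i≢m ∘ sym))) (ZP.*-zeroˡ (f (n ∸ i)))

  monomial-⊛-> : ∀ m f n → n ℕ.< m → (monomial m ⊛ f) n ≡ 0ℤ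
  monomial-⊛-> m f n n<m = trans (⊛-coeff (monomial m) f n) (Σ-zero (suc n) vanish)
    where
    vanish : ∀ i → i ℕ.< suc n → monomial m i * f (n ∸ i) ≡ 0ℤ
    vanish i i<n = trans (cong (_* f (n ∸ i)) (monomial-off m i (λ e → NP.<⇒≢ (NP.≤-<-trans (NP.≤-pred i<n) n<m) (sym e))))
                         (ZP.*-zeroˡ (f (n ∸ i)))

  one-⊛ : ∀ f → (onePS ⊛ f) ≗ f
  one-⊛ f n = monomial-⊛-≤ 0 f n z≤n

  ⊛-one : ∀ f → (f ⊛ onePS) ≗ f
  ⊛-one f n = trans (⊛-comm f onePS n) (one-⊛ f n)

  monomial-+ : ∀ a b → (monomial a ⊛ monomial b) ≗ monomial (a ℕ.+ b)
  monomial-+ a b n with a ℕ.≤? n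
  ... | no a≰n = trans (monomial-⊛-> a (monomial b) n (NP.≰⇒> a≰n))
                   (sym (monomial-off _ n (λ e → a≰n (NP.≤-trans (NP.m≤m+n a b) (NP.≤-reflexive e)))))
  ... | yes a≤n with b ℕ.≟ (n ∸ a)
  ...   | yes refl = trans (monomial-⊛-≤ a (monomial b) n a≤n)
                       (trans (monomial-diag (n ∸ a)) (sym (trans (cong (λ m → monomial m n) (NP.m+[n∸m]≡n a≤n)) (monomial-diag n))))
  ...   | no b≢n∸a = trans (monomial-⊛-≤ a (monomial b) n a≤n)
                       (trans (monomial-off b _ b≢n∸a)
                              (sym (monomial-off _ n (λ e → b≢n∸a (sym (trans (cong (_∸ a) (sym e)) (NP.m+n∸m≡n a b)))))))

module PowerSeriesRing where

  open PowerSeriesAlgebra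
  open import Data.Integer as ℤ using (ℤ; -_)
  import Data.Integer.Properties as ZP
  open import Relation.Binary.PropositionalEquality
  open import Relation.Nullary using (yes; no)
  open import Relation.Binary.Structures using (IsEquivalence)
  open import Relation.Binary.Bundles using (Setoid)
  open import Relation.Binary.Definitions using (WeaklyDecidable)
  open import Algebra.Bundles using (CommutativeRing)
  open import Algebra.Solver.Ring.AlmostCommutativeRing
    using (AlmostCommutativeRing; fromCommutativeRing; _-Raw-AlmostCommutative⟶_; Induced-equivalence)
  open import Data.Product using (_,_)
  open import Data.Maybe using (just; nothing)
  open import Level using (0ℓ)

  negPS : PowerSeries → PowerSeries
  negPS f n = - f n

  negPS-cong : ∀ {f g} → f ≗ g → negPS f ≗ negPS g
  negPS-cong p n = cong -_ (p n)

  ≗-isEquivalence : IsEquivalence {A = PowerSeries} _≗_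
  ≗-isEquivalence = record
    { refl = λ _ → refl ; sym = λ p n → sym (p n) ; trans = λ p q n → trans (p n) (q n) }

  powerSeriesSetoid : Setoid 0ℓ 0ℓ
  powerSeriesSetoid = record { Carrier = PowerSeries ; _≈_ = _≗_ ; isEquivalence = ≗-isEquivalence }

  open Setoid powerSeriesSetoid public using () renaming (refl to ≗-refl; sym to ≗-sym; trans to ≗-trans)

  powerSeriesRing : CommutativeRing 0ℓ 0ℓ
  powerSeriesRing = record
    { Carrier = PowerSeries ; _≈_ = _≗_ ; _+_ = _⊕_ ; _*_ = _⊛_ ; -_ = negPS ; 0# = zeroPS ; 1# = onePS
    ; isCommutativeRing = record
      { isRing = record
        { +-isAbelianGroup = record
          { isGroup = record
            { isMonoid = record
              { isSemigroup = record
                { isMagma = record { isEquivalence = ≗-isEquivalence ; ∙-cong = ⊕-cong }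
                ; assoc = λ f g h n → ZP.+-assoc (f n) (g n) (h n) }
              ; identity = (λ f n → ZP.+-identityˡ (f n)) , (λ f n → ZP.+-identityʳ (f n)) }
            ; inverse = (λ f n → ZP.+-inverseˡ (f n)) , (λ f n → ZP.+-inverseʳ (f n))
            ; ⁻¹-cong = negPS-cong }
          ; comm = λ f g n → ZP.+-comm (f n) (g n) }
        ; *-cong = ⊛-cong
        ; *-assoc = ⊛-assoc
        ; *-identity = one-⊛ , ⊛-one
        ; distrib = (λ h f g → ⊛-distribˡ f g h) , (λ h f g → ⊛-distribʳ f g h) }
      ; *-comm = ⊛-comm } }

  open CommutativeRing powerSeriesRing public using ()
    renaming (+-identityˡ to zero-⊕; +-identityʳ to ⊕-zero; -‿inverseʳ to ⊕-neg)

  -- One-sided congruences, with the fixed factor explicit (it cannot be inferred from _≗_).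
  ⊛-congˡ : ∀ f {g g′} → g ≗ g′ → (f ⊛ g) ≗ (f ⊛ g′)
  ⊛-congˡ f = ⊛-cong {f} {f} (λ _ → refl)

  ⊛-congʳ : ∀ {f f′} g → f ≗ f′ → (f ⊛ g) ≗ (f′ ⊛ g)
  ⊛-congʳ g p = ⊛-cong {g = g} {g′ = g} p (λ _ → refl)

  ⊕-congˡ : ∀ f {g g′} → g ≗ g′ → (f ⊕ g) ≗ (f ⊕ g′)
  ⊕-congˡ f p n = cong (λ x → f n ℤ.+ x) (p n)

  ⊕-congʳ : ∀ {f f′} g → f ≗ f′ → (f ⊕ g) ≗ (f′ ⊕ g)
  ⊕-congʳ g p n = cong (λ x → x ℤ.+ g n) (p n)

  private
    powerSeriesACR : AlmostCommutativeRing 0ℓ 0ℓ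
    powerSeriesACR = fromCommutativeRing powerSeriesRing

    constant : CommutativeRing.rawRing ZP.+-*-commutativeRing -Raw-AlmostCommutative⟶ powerSeriesACR
    constant = record
      { ⟦_⟧    = λ c → scale c onePS
      ; +-homo = λ c d n → ZP.*-distribʳ-+ (onePS n) c d
      ; *-homo = λ c d n → sym (trans (scale-⊛ c onePS (scale d onePS) n)
                                (trans (cong (c ℤ.*_) (one-⊛ (scale d onePS) n)) (sym (ZP.*-assoc c d (onePS n)))))
      ; -‿homo = λ c n → sym (ZP.neg-distribˡ-* c (onePS n))
      ; 0-homo = λ n → ZP.*-zeroˡ (onePS n)
      ; 1-homo = λ n → ZP.*-identityˡ (onePS n) }

    constant? : WeaklyDecidable (Induced-equivalence constant)
    constant? c d with c ZP.≟ d
    ... | yes refl = just (λ _ → refl)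
    ... | no _     = nothing

  open import Algebra.Solver.Ring (CommutativeRing.rawRing ZP.+-*-commutativeRing) powerSeriesACR constant constant? public
    using (solve; _:=_; _:+_; _:*_; :-_)

module Geometric where

  open PowerSeriesAlgebra
  open PowerSeriesRing using (negPS)
  open import Data.Bool using (Bool; true; false; if_then_else_)
  open import Data.Nat as ℕ using (ℕ; zero; suc; _∸_; z≤n; s≤s; _≡ᵇ_; _*_)
  import Data.Nat.Properties as NP
  open import Data.Integer as ℤ using (0ℤ; _+_)
  import Data.Integer.Properties as ZP
  open import Data.List using (applyUpTo; filterᵇ; length)
  open import Function using (_∘_; id)
  open import Relation.Binary.PropositionalEquality
  open import Relation.Nullary using (¬_; yes; no)

  countBelow : (ℕ → Bool) → ℕ → ℕ
  countBelow p zero    = 0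
  countBelow p (suc K) = (if p 0 then 1 else 0) ℕ.+ countBelow (p ∘ suc) K

  length-filter-applyUpTo : ∀ (p : ℕ → Bool) (f : ℕ → ℕ) K →
    length (filterᵇ p (applyUpTo f K)) ≡ countBelow (p ∘ f) K
  length-filter-applyUpTo p f zero = refl
  length-filter-applyUpTo p f (suc K) with p (f 0)
  ... | true  = cong suc (length-filter-applyUpTo p (f ∘ suc) K)
  ... | false = length-filter-applyUpTo p (f ∘ suc) K

  countBelow-none : ∀ p K → (∀ j → j ℕ.< K → p j ≡ false) → countBelow p K ≡ 0
  countBelow-none p zero    h = refl
  countBelow-none p (suc K) h rewrite h 0 (s≤s z≤n) = countBelow-none (p ∘ suc) K (λ j j<K → h (suc j) (s≤s j<K))

  countBelow-ext : ∀ p p′ K → (∀ j → p j ≡ p′ j) → countBelow p K ≡ countBelow p′ K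
  countBelow-ext p p′ zero    h = refl
  countBelow-ext p p′ (suc K) h rewrite h 0 = cong (_ ℕ.+_) (countBelow-ext (p ∘ suc) (p′ ∘ suc) K (h ∘ suc))

  countBelow-snoc : ∀ p K → countBelow p (suc K) ≡ countBelow p K ℕ.+ (if p K then 1 else 0)
  countBelow-snoc p zero    = NP.+-comm _ 0
  countBelow-snoc p (suc K) =
    trans (cong ((if p 0 then 1 else 0) ℕ.+_) (countBelow-snoc (p ∘ suc) K))
          (sym (NP.+-assoc (if p 0 then 1 else 0) (countBelow (p ∘ suc) K) _))

  countBelow-stable : ∀ p K₀ K → K₀ ℕ.≤ K → (∀ j → K₀ ℕ.≤ j → p j ≡ false) → countBelow p K ≡ countBelow p K₀
  countBelow-stable p .zero zero z≤n h = refl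
  countBelow-stable p K₀ (suc K) K₀≤1+K h with K₀ ℕ.≤? K
  ... | yes K₀≤K = begin
    countBelow p (suc K)                              ≡⟨ countBelow-snoc p K ⟩
    countBelow p K ℕ.+ (if p K then 1 else 0)         ≡⟨ cong (λ c → countBelow p K ℕ.+ (if c then 1 else 0)) (h K K₀≤K) ⟩
    countBelow p K ℕ.+ 0                              ≡⟨ NP.+-identityʳ _ ⟩
    countBelow p K                                    ≡⟨ countBelow-stable p K₀ K K₀≤K h ⟩
    countBelow p K₀                                   ∎
    where open ≡-Reasoning
  ... | no K₀≰K = cong (countBelow p) (sym (NP.≤-antisym K₀≤1+K (NP.≰⇒> K₀≰K)))

  geometric-count : ∀ m n → geometric m n ≡ ℤ.+ countBelow (λ j → m * j ≡ᵇ n) (suc n)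
  geometric-count m n = cong ℤ.+_ (length-filter-applyUpTo (λ j → m * j ≡ᵇ n) id (suc n))

  geometric-0 : ∀ m → geometric m 0 ≡ ℤ.1ℤ
  geometric-0 m rewrite geometric-count m 0 | NP.*-zeroʳ m = refl

  -- No multiple of m lies strictly between 0 and m.
  geometric-gap : ∀ m n → 0 ℕ.< n → n ℕ.< m → geometric m n ≡ 0ℤ
  geometric-gap m n 0<n n<m =
    trans (geometric-count m n) (cong ℤ.+_ (countBelow-none _ (suc n) (λ j _ → ≡ᵇ-≢ (m * j) n (notMultiple j))))
    where
    notMultiple : ∀ j → ¬ m * j ≡ n
    notMultiple zero    e = NP.<⇒≢ 0<n (trans (sym (NP.*-zeroʳ m)) e)
    notMultiple (suc j) e = NP.<⇒≢ (NP.<-≤-trans n<m (NP.≤-trans (NP.m≤m+n m (m * j)) (NP.≤-reflexive (sym (NP.*-suc m j))))) (sym e)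

  ≡ᵇ-+ˡ : ∀ m x y → (m ℕ.+ x ≡ᵇ m ℕ.+ y) ≡ (x ≡ᵇ y)
  ≡ᵇ-+ˡ zero    x y = refl
  ≡ᵇ-+ˡ (suc m) x y = ≡ᵇ-+ˡ m x y

  -- The coefficients are m-periodic: m·j = m + n has the solutions j = j′ + 1 with m·j′ = n.
  geometric-periodic : ∀ m n → 1 ℕ.≤ m → geometric m (m ℕ.+ n) ≡ geometric m n
  geometric-periodic m n 1≤m = begin
    geometric m (m ℕ.+ n)
      ≡⟨ geometric-count m (m ℕ.+ n) ⟩
    ℤ.+ countBelow (λ j → m * j ≡ᵇ m ℕ.+ n) (suc (m ℕ.+ n))
      ≡⟨ cong (λ c → ℤ.+ ((if c then 1 else 0) ℕ.+ countBelow (λ j → m * suc j ≡ᵇ m ℕ.+ n) (m ℕ.+ n))) j≢0 ⟩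
    ℤ.+ countBelow (λ j → m * suc j ≡ᵇ m ℕ.+ n) (m ℕ.+ n)
      ≡⟨ cong ℤ.+_ (countBelow-ext _ _ (m ℕ.+ n) (λ j → trans (cong (_≡ᵇ m ℕ.+ n) (NP.*-suc m j)) (≡ᵇ-+ˡ m (m * j) n))) ⟩
    ℤ.+ countBelow (λ j → m * j ≡ᵇ n) (m ℕ.+ n)
      ≡⟨ cong ℤ.+_ (countBelow-stable _ (suc n) (m ℕ.+ n) (NP.+-monoˡ-≤ n 1≤m) (λ j n<j → ≡ᵇ-≢ (m * j) n (tooLarge j n<j))) ⟩
    ℤ.+ countBelow (λ j → m * j ≡ᵇ n) (suc n)
      ≡⟨ sym (geometric-count m n) ⟩
    geometric m n ∎
    where
    open ≡-Reasoning
    j≢0 : (m * 0 ≡ᵇ m ℕ.+ n) ≡ false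
    j≢0 = ≡ᵇ-≢ (m * 0) (m ℕ.+ n)
            (λ e → NP.<⇒≢ (NP.<-≤-trans (s≤s z≤n) (NP.≤-trans 1≤m (NP.m≤m+n m n))) (trans (sym (NP.*-zeroʳ m)) e))
    tooLarge : ∀ j → suc n ℕ.≤ j → ¬ m * j ≡ n
    tooLarge j n<j e = NP.<⇒≢ (NP.<-≤-trans n<j (NP.m≤n*m j m {{ℕ.>-nonZero 1≤m}})) (sym e)

  geometric-inverse : ∀ m → 1 ℕ.≤ m → (geometric m ⊕ negPS (monomial m ⊛ geometric m)) ≗ onePS
  geometric-inverse m 1≤m n with m ℕ.≤? n
  ... | yes m≤n = begin
    geometric m n + ℤ.- (monomial m ⊛ geometric m) n
      ≡⟨ cong (λ x → geometric m n + ℤ.- x) (monomial-⊛-≤ m (geometric m) n m≤n) ⟩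
    geometric m n + ℤ.- geometric m (n ∸ m)
      ≡⟨ cong (λ k → geometric m k + ℤ.- geometric m (n ∸ m)) (sym (NP.m+[n∸m]≡n m≤n)) ⟩
    geometric m (m ℕ.+ (n ∸ m)) + ℤ.- geometric m (n ∸ m)
      ≡⟨ cong (_+ ℤ.- geometric m (n ∸ m)) (geometric-periodic m (n ∸ m) 1≤m) ⟩
    geometric m (n ∸ m) + ℤ.- geometric m (n ∸ m)
      ≡⟨ ZP.+-inverseʳ (geometric m (n ∸ m)) ⟩
    0ℤ
      ≡⟨ sym (monomial-off 0 n (NP.<⇒≢ (NP.<-≤-trans (s≤s z≤n) (NP.≤-trans 1≤m m≤n)))) ⟩
    onePS n ∎
    where open ≡-Reasoning
  ... | no m≰n = trans (cong (λ x → geometric m n + ℤ.- x) (monomial-⊛-> m (geometric m) n (NP.≰⇒> m≰n)))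
                       (trans (ZP.+-identityʳ _) (belowPeriod n (NP.≰⇒> m≰n)))
    where
    belowPeriod : ∀ k → k ℕ.< m → geometric m k ≡ onePS k
    belowPeriod zero    _   = geometric-0 m
    belowPeriod (suc k) k<m = trans (geometric-gap m (suc k) (s≤s z≤n) k<m) (sym (monomial-off 0 (suc k) (λ ())))

-- Gcap x μ     = Σ_{ν ⊆ μ, ν₁ ≤ x} q^{|ν|}
--   Gshift d λ   = Σ_{ν ⊆ λ} q^{|ν| + d·ν₁}
-- Both are defined by recursion on the list of parts.
module SubPartitionSeries where

  open PowerSeriesAlgebra
  open PowerSeriesRing
  open import Data.Nat as ℕ using (ℕ; zero; suc; z≤n; s≤s; _⊓_; _*_)
  import Data.Nat.Properties as NP
  open import Data.List using (List; []; _∷_)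
  open import Data.Unit using (⊤)
  open import Relation.Nullary using (yes; no)
  open import Data.Product using (_×_)
  open import Relation.Binary.PropositionalEquality using (_≡_; _≗_; refl; sym; cong)
  open import Relation.Binary.Reasoning.Setoid powerSeriesSetoid

  q : ℕ → PowerSeries
  q = monomial

  q-cong : ∀ {a b} → a ≡ b → q a ≗ q b
  q-cong refl n = refl

  q⊛-vanishes : ∀ a {f} → f ≗ zeroPS → (q a ⊛ f) ≗ zeroPS
  q⊛-vanishes a f≗0 = ≗-trans (⊛-congˡ (q a) f≗0) (⊛-zero (q a))

  sumPS : ℕ → (ℕ → PowerSeries) → PowerSeries
  sumPS zero    h = zeroPS
  sumPS (suc n) h = sumPS n h ⊕ h n

  sumPS-cong : ∀ n {h h′ : ℕ → PowerSeries} → (∀ x → x ℕ.< n → h x ≗ h′ x) → sumPS n h ≗ sumPS n h′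
  sumPS-cong zero    p = ≗-refl
  sumPS-cong (suc n) p = ⊕-cong (sumPS-cong n (λ x x<n → p x (NP.m<n⇒m<1+n x<n))) (p n NP.≤-refl)

  sumPS-bound : ∀ {n n′} (h : ℕ → PowerSeries) → n ≡ n′ → sumPS n h ≗ sumPS n′ h
  sumPS-bound h refl = ≗-refl

  sumPS-truncate : ∀ n L (h : ℕ → PowerSeries) → L ℕ.≤ n → (∀ x → L ℕ.≤ x → x ℕ.< n → h x ≗ zeroPS) →
    sumPS n h ≗ sumPS L h
  sumPS-truncate zero .zero h z≤n z = ≗-refl
  sumPS-truncate (suc n) L h L≤1+n z with L ℕ.≤? n
  ... | yes L≤n = begin
    sumPS n h ⊕ h n      ≈⟨ ⊕-congˡ (sumPS n h) (z n L≤n NP.≤-refl) ⟩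
    sumPS n h ⊕ zeroPS   ≈⟨ ⊕-zero (sumPS n h) ⟩
    sumPS n h            ≈⟨ sumPS-truncate n L h L≤n (λ x L≤x x<n → z x L≤x (NP.m<n⇒m<1+n x<n)) ⟩
    sumPS L h            ∎
  ... | no L≰n = sumPS-bound h (NP.≤-antisym (NP.≰⇒> L≰n) L≤1+n)

  -- Forward differences of a sequence of power series (with s (-1) = 0).
  difference : (ℕ → PowerSeries) → ℕ → PowerSeries
  difference s zero    = s 0
  difference s (suc x) = s (suc x) ⊕ negPS (s x)

  telescope : ∀ e (s : ℕ → PowerSeries) l →
    (sumPS (suc l) (λ x → q (e * x) ⊛ s x) ⊕ negPS (q e ⊛ sumPS (suc l) (λ x → q (e * x) ⊛ s x)))
    ≗ (sumPS (suc l) (λ x → q (e * x) ⊛ difference s x) ⊕ negPS (q (e * suc l) ⊛ s l))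
  telescope e s zero = ⊕-congˡ (zeroPS ⊕ (q (e * 0) ⊛ s 0)) (negPS-cong (⊛-cong (q-cong (sym (NP.*-identityʳ e))) firstTerm))
    where
    firstTerm : (zeroPS ⊕ (q (e * 0) ⊛ s 0)) ≗ s 0
    firstTerm = begin
      zeroPS ⊕ (q (e * 0) ⊛ s 0)  ≈⟨ zero-⊕ _ ⟩
      q (e * 0) ⊛ s 0             ≈⟨ ⊛-congʳ (s 0) (q-cong (NP.*-zeroʳ e)) ⟩
      q 0 ⊛ s 0                   ≈⟨ one-⊛ (s 0) ⟩
      s 0                         ∎
  telescope e s (suc l) = begin
    (S ⊕ A) ⊕ negPS (q e ⊛ (S ⊕ A))
      ≈⟨ regroup S A (q e) ⟩
    (S ⊕ negPS (q e ⊛ S)) ⊕ (A ⊕ negPS (q e ⊛ A))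
      ≈⟨ ⊕-congʳ (A ⊕ negPS (q e ⊛ A)) (telescope e s l) ⟩
    (D ⊕ negPS (Q ⊛ s l)) ⊕ ((Q ⊛ s (suc l)) ⊕ negPS (q e ⊛ (Q ⊛ s (suc l))))
      ≈⟨ collect D Q (s l) (s (suc l)) (q e) ⟩
    (D ⊕ (Q ⊛ (s (suc l) ⊕ negPS (s l)))) ⊕ negPS ((q e ⊛ Q) ⊛ s (suc l))
      ≈⟨ ⊕-congˡ (D ⊕ (Q ⊛ (s (suc l) ⊕ negPS (s l)))) (negPS-cong (⊛-congʳ (s (suc l)) nextPower)) ⟩
    (D ⊕ (Q ⊛ (s (suc l) ⊕ negPS (s l)))) ⊕ negPS (q (e * suc (suc l)) ⊛ s (suc l)) ∎
    where
    S = sumPS (suc l) (λ x → q (e * x) ⊛ s x)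
    D = sumPS (suc l) (λ x → q (e * x) ⊛ difference s x)
    Q = q (e * suc l)
    A = Q ⊛ s (suc l)
    nextPower : (q e ⊛ Q) ≗ q (e * suc (suc l))
    nextPower = ≗-trans (monomial-+ e (e * suc l)) (q-cong (sym (NP.*-suc e (suc l))))
    regroup : ∀ S A E → ((S ⊕ A) ⊕ negPS (E ⊛ (S ⊕ A))) ≗ ((S ⊕ negPS (E ⊛ S)) ⊕ (A ⊕ negPS (E ⊛ A)))
    regroup = solve 3 (λ S A E → ((S :+ A) :+ (:- (E :* (S :+ A)))) := ((S :+ (:- (E :* S))) :+ (A :+ (:- (E :* A))))) ≗-refl
    collect : ∀ D Q s₀ s₁ E →
      ((D ⊕ negPS (Q ⊛ s₀)) ⊕ ((Q ⊛ s₁) ⊕ negPS (E ⊛ (Q ⊛ s₁))))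
      ≗ ((D ⊕ (Q ⊛ (s₁ ⊕ negPS s₀))) ⊕ negPS ((E ⊛ Q) ⊛ s₁))
    collect = solve 5 (λ D Q s₀ s₁ E → ((D :+ (:- (Q :* s₀))) :+ ((Q :* s₁) :+ (:- (E :* (Q :* s₁)))))
                                        := ((D :+ (Q :* (s₁ :+ (:- s₀)))) :+ (:- ((E :* Q) :* s₁)))) ≗-refl

  -- Gcap x (l, μ) sums over the first part y ≤ min(x, l) of ν; the rest of ν is capped by y.
  Gcap : ℕ → List ℕ → PowerSeries
  Gcap x []       = onePS
  Gcap x (l ∷ μ)  = sumPS (suc (x ⊓ l)) (λ y → q y ⊛ Gcap y μ)

  -- Gshift d (l, μ) weights the first part x ≤ l of ν by q^{(d+1)x}.
  Gshift : ℕ → List ℕ → PowerSeries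
  Gshift d []      = onePS
  Gshift d (l ∷ μ) = sumPS (suc l) (λ x → q (suc d * x) ⊛ Gcap x μ)

  HeadLe : ℕ → List ℕ → Set
  HeadLe l []       = ⊤
  HeadLe l (l′ ∷ _) = l′ ℕ.≤ l

  WeaklyDecreasing : List ℕ → Set
  WeaklyDecreasing []      = ⊤
  WeaklyDecreasing (l ∷ μ) = HeadLe l μ × WeaklyDecreasing μ

  -- A cap at least the first part is no constraint.
  Gcap-uncapped : ∀ l μ → HeadLe l μ → Gcap l μ ≗ Gshift 0 μ
  Gcap-uncapped l []       _     = ≗-refl
  Gcap-uncapped l (l′ ∷ μ) l′≤l = begin
    sumPS (suc (l ⊓ l′)) (λ y → q y ⊛ Gcap y μ)
      ≈⟨ sumPS-bound _ (cong suc (NP.m≥n⇒m⊓n≡n l′≤l)) ⟩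
    sumPS (suc l′) (λ y → q y ⊛ Gcap y μ)
      ≈⟨ sumPS-cong (suc l′) (λ x _ → ⊛-congʳ (Gcap x μ) (q-cong (sym (NP.+-identityʳ x)))) ⟩
    sumPS (suc l′) (λ x → q (1 * x) ⊛ Gcap x μ) ∎

  -- Differences of x ↦ Gcap x μ: raising the cap from x-1 to x adds the ν with ν₁ = x.
  difference-Gcap-[] : ∀ x → 1 ℕ.≤ x → difference (λ y → Gcap y []) x ≗ zeroPS
  difference-Gcap-[] (suc x) _ = ⊕-neg onePS

  difference-Gcap-≤ : ∀ l′ μ x → x ℕ.≤ l′ → difference (λ y → Gcap y (l′ ∷ μ)) x ≗ (q x ⊛ Gcap x μ)
  difference-Gcap-≤ l′ μ zero    _     = zero-⊕ _
  difference-Gcap-≤ l′ μ (suc x) x<l′ = begin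
    sumPS (suc (suc x ⊓ l′)) h ⊕ negPS (sumPS (suc (x ⊓ l′)) h)
      ≈⟨ ⊕-cong (sumPS-bound h (cong suc (NP.m≤n⇒m⊓n≡m x<l′)))
                (negPS-cong (sumPS-bound h (cong suc (NP.m≤n⇒m⊓n≡m (NP.≤-trans (NP.n≤1+n x) x<l′))))) ⟩
    (sumPS (suc x) h ⊕ h (suc x)) ⊕ negPS (sumPS (suc x) h)
      ≈⟨ solve 2 (λ A B → ((A :+ B) :+ (:- A)) := B) ≗-refl (sumPS (suc x) h) (h (suc x)) ⟩
    h (suc x) ∎
    where h = λ y → q y ⊛ Gcap y μ

  difference-Gcap-> : ∀ l′ μ x → l′ ℕ.< x → difference (λ y → Gcap y (l′ ∷ μ)) x ≗ zeroPS
  difference-Gcap-> l′ μ (suc x) (s≤s l′≤x) = begin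
    sumPS (suc (suc x ⊓ l′)) h ⊕ negPS (sumPS (suc (x ⊓ l′)) h)
      ≈⟨ ⊕-cong (sumPS-bound h (cong suc (NP.m≥n⇒m⊓n≡n (NP.≤-trans l′≤x (NP.n≤1+n x)))))
                (negPS-cong (sumPS-bound h (cong suc (NP.m≥n⇒m⊓n≡n l′≤x)))) ⟩
    sumPS (suc l′) h ⊕ negPS (sumPS (suc l′) h)
      ≈⟨ ⊕-neg (sumPS (suc l′) h) ⟩
    zeroPS ∎
    where h = λ y → q y ⊛ Gcap y μ

  sum-difference-Gcap : ∀ d l μ → HeadLe l μ →
    sumPS (suc l) (λ x → q (suc d * x) ⊛ difference (λ y → Gcap y μ) x) ≗ Gshift (suc d) μ
  sum-difference-Gcap d l [] _ = begin
    sumPS (suc l) (λ x → q (suc d * x) ⊛ difference (λ y → Gcap y []) x)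
      ≈⟨ sumPS-truncate (suc l) 1 _ (s≤s z≤n) (λ x 1≤x _ → q⊛-vanishes (suc d * x) (difference-Gcap-[] x 1≤x)) ⟩
    zeroPS ⊕ (q (suc d * 0) ⊛ onePS)  ≈⟨ zero-⊕ _ ⟩
    q (suc d * 0) ⊛ onePS             ≈⟨ ⊛-one _ ⟩
    q (suc d * 0)                     ≈⟨ q-cong (NP.*-zeroʳ (suc d)) ⟩
    onePS                             ∎
  sum-difference-Gcap d l (l′ ∷ μ) l′≤l = begin
    sumPS (suc l) (λ x → q (suc d * x) ⊛ difference (λ y → Gcap y (l′ ∷ μ)) x)
      ≈⟨ sumPS-truncate (suc l) (suc l′) _ (s≤s l′≤l)
                        (λ x l′<x _ → q⊛-vanishes (suc d * x) (difference-Gcap-> l′ μ x l′<x)) ⟩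
    sumPS (suc l′) (λ x → q (suc d * x) ⊛ difference (λ y → Gcap y (l′ ∷ μ)) x)
      ≈⟨ sumPS-cong (suc l′) (λ x x<l′ → summand x (NP.≤-pred x<l′)) ⟩
    sumPS (suc l′) (λ x → q (suc (suc d) * x) ⊛ Gcap x μ) ∎
    where
    summand : ∀ x → x ℕ.≤ l′ → (q (suc d * x) ⊛ difference (λ y → Gcap y (l′ ∷ μ)) x) ≗ (q (suc (suc d) * x) ⊛ Gcap x μ)
    summand x x≤l′ = begin
      q (suc d * x) ⊛ difference (λ y → Gcap y (l′ ∷ μ)) x  ≈⟨ ⊛-congˡ (q (suc d * x)) (difference-Gcap-≤ l′ μ x x≤l′) ⟩
      q (suc d * x) ⊛ (q x ⊛ Gcap x μ)                     ≈⟨ ≗-sym (⊛-assoc (q (suc d * x)) (q x) (Gcap x μ)) ⟩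
      (q (suc d * x) ⊛ q x) ⊛ Gcap x μ                     ≈⟨ ⊛-congʳ (Gcap x μ) (monomial-+ (suc d * x) x) ⟩
      q (suc d * x ℕ.+ x) ⊛ Gcap x μ                       ≈⟨ ⊛-congʳ (Gcap x μ) (q-cong (NP.+-comm (suc d * x) x)) ⟩
      q (suc (suc d) * x) ⊛ Gcap x μ                       ∎

  Gshift-recursion : ∀ d l μ → HeadLe l μ →
    (Gshift d (l ∷ μ) ⊕ negPS (q (suc d) ⊛ Gshift d (l ∷ μ))) ≗ (Gshift (suc d) μ ⊕ negPS (q (suc d * suc l) ⊛ Gcap l μ))
  Gshift-recursion d l μ l≥μ = begin
    Gshift d (l ∷ μ) ⊕ negPS (q (suc d) ⊛ Gshift d (l ∷ μ))
      ≈⟨ telescope (suc d) (λ x → Gcap x μ) l ⟩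
    sumPS (suc l) (λ x → q (suc d * x) ⊛ difference (λ y → Gcap y μ) x) ⊕ negPS (q (suc d * suc l) ⊛ Gcap l μ)
      ≈⟨ ⊕-congʳ (negPS (q (suc d * suc l) ⊛ Gcap l μ)) (sum-difference-Gcap d l μ l≥μ) ⟩
    Gshift (suc d) μ ⊕ negPS (q (suc d * suc l) ⊛ Gcap l μ) ∎

module ListFacts where

  open PowerSeriesAlgebra
  open PowerSeriesRing
  open SubPartitionSeries using (sumPS)
  open import Data.Bool using (Bool; true; false; T; T?)
  open import Data.Nat as ℕ using (ℕ; zero; suc; _≤ᵇ_)
  import Data.Nat.Properties as NP
  open import Data.Integer as ℤ using ()
  import Data.Integer.Properties as ZP
  open import Data.List using (List; []; _∷_; map; upTo; applyUpTo; filterᵇ; concatMap; _++_)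
  open import Data.Nat.ListAction using (sum)
  import Data.List.Properties as LP
  open import Data.List.Relation.Unary.All using (All; []; _∷_)
  open import Function using (_∘_)
  open import Relation.Binary.PropositionalEquality
  open import Data.Empty using (⊥-elim)

  ≤ᵇ-true : ∀ {m n} → m ℕ.≤ n → (m ≤ᵇ n) ≡ true
  ≤ᵇ-true {m} {n} m≤n with m ≤ᵇ n | NP.≤⇒≤ᵇ m≤n
  ... | true | _ = refl

  ≤ᵇ-false : ∀ {m n} → n ℕ.< m → (m ≤ᵇ n) ≡ false
  ≤ᵇ-false {m} {n} n<m with m ≤ᵇ n in eq
  ... | false = refl
  ... | true  = ⊥-elim (NP.<⇒≱ n<m (NP.≤ᵇ⇒≤ m n (subst T (sym eq) _)))

  filterᵇ-++ : ∀ {A : Set} (p : A → Bool) xs ys → filterᵇ p (xs ++ ys) ≡ filterᵇ p xs ++ filterᵇ p ys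
  filterᵇ-++ p = LP.filter-++ (T? ∘ p)

  filterᵇ-map : ∀ {A B : Set} (p : B → Bool) (f : A → B) xs → filterᵇ p (map f xs) ≡ map f (filterᵇ (p ∘ f) xs)
  filterᵇ-map p f []       = refl
  filterᵇ-map p f (x ∷ xs) with p (f x)
  ... | true  = cong (f x ∷_) (filterᵇ-map p f xs)
  ... | false = filterᵇ-map p f xs

  filterᵇ-none : ∀ {A : Set} (p : A → Bool) xs → (∀ a → p a ≡ false) → filterᵇ p xs ≡ []
  filterᵇ-none p []       h = refl
  filterᵇ-none p (x ∷ xs) h rewrite h x = filterᵇ-none p xs h

  filterᵇ-all : ∀ {A : Set} (p : A → Bool) xs → All (λ a → p a ≡ true) xs → filterᵇ p xs ≡ xs
  filterᵇ-all p []       []         = refl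
  filterᵇ-all p (x ∷ xs) (px ∷ pxs) rewrite px = cong (x ∷_) (filterᵇ-all p xs pxs)

  filterᵇ-cong : ∀ {A : Set} {P : A → Set} (p p′ : A → Bool) xs → All P xs → (∀ a → P a → p a ≡ p′ a) →
    filterᵇ p xs ≡ filterᵇ p′ xs
  filterᵇ-cong p p′ []       []         h = refl
  filterᵇ-cong p p′ (x ∷ xs) (px ∷ pxs) h rewrite h x px with p′ x
  ... | true  = cong (x ∷_) (filterᵇ-cong p p′ xs pxs h)
  ... | false = filterᵇ-cong p p′ xs pxs h

  ΣPS-++ : ∀ xs ys → ΣPS (xs ++ ys) ≗ (ΣPS xs ⊕ ΣPS ys)
  ΣPS-++ []       ys n = sym (ZP.+-identityˡ _)
  ΣPS-++ (x ∷ xs) ys n = trans (cong (λ z → x n ℤ.+ z) (ΣPS-++ xs ys n)) (sym (ZP.+-assoc (x n) _ _))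

  ΣPS-map-cong : ∀ {A : Set} {F G : A → PowerSeries} xs → (∀ a → F a ≗ G a) → ΣPS (map F xs) ≗ ΣPS (map G xs)
  ΣPS-map-cong []       h n = refl
  ΣPS-map-cong (x ∷ xs) h n = cong₂ ℤ._+_ (h x n) (ΣPS-map-cong xs h n)

  ΣPS-upTo : ∀ n (h : ℕ → PowerSeries) → ΣPS (map h (upTo n)) ≗ sumPS n h
  ΣPS-upTo n h k = trans (cong (λ xs → ΣPS xs k) (LP.map-upTo h n)) (ΣPS-applyUpTo n h k)
    where
    sumPS-head : ∀ n (h : ℕ → PowerSeries) → sumPS (suc n) h ≗ (h 0 ⊕ sumPS n (h ∘ suc))
    sumPS-head zero    h k = trans (ZP.+-identityˡ (h 0 k)) (sym (ZP.+-identityʳ (h 0 k)))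
    sumPS-head (suc n) h k = trans (cong (ℤ._+ h (suc n) k) (sumPS-head n h k)) (ZP.+-assoc (h 0 k) _ _)
    ΣPS-applyUpTo : ∀ n (h : ℕ → PowerSeries) → ΣPS (applyUpTo h n) ≗ sumPS n h
    ΣPS-applyUpTo zero    h = ≗-refl
    ΣPS-applyUpTo (suc n) h = ≗-trans (⊕-congˡ (h 0) (ΣPS-applyUpTo n (h ∘ suc))) (≗-sym (sumPS-head n h))

  applyUpTo-cong : ∀ {X : Set} {f g : ℕ → X} n → (∀ i → f i ≡ g i) → applyUpTo f n ≡ applyUpTo g n
  applyUpTo-cong zero    h = refl
  applyUpTo-cong (suc n) h = cong₂ _∷_ (h 0) (applyUpTo-cong n (h ∘ suc))

  sum-applyUpTo-const : ∀ c n → sum (applyUpTo (λ _ → c) n) ≡ n ℕ.* c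
  sum-applyUpTo-const c zero    = refl
  sum-applyUpTo-const c (suc n) = cong (c ℕ.+_) (sum-applyUpTo-const c n)

  ΠPS-++ : ∀ xs ys → ΠPS (xs ++ ys) ≗ (ΠPS xs ⊛ ΠPS ys)
  ΠPS-++ []       ys = ≗-sym (one-⊛ (ΠPS ys))
  ΠPS-++ (x ∷ xs) ys = ≗-trans (⊛-congˡ x (ΠPS-++ xs ys)) (≗-sym (⊛-assoc x (ΠPS xs) (ΠPS ys)))

  ΣPS-filter-concatMap : ∀ {A B : Set} (F : B → PowerSeries) (p : B → Bool) (g : A → List B) xs →
    ΣPS (map F (filterᵇ p (concatMap g xs))) ≗ ΣPS (map (λ a → ΣPS (map F (filterᵇ p (g a)))) xs)
  ΣPS-filter-concatMap F p g []       = ≗-refl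
  ΣPS-filter-concatMap F p g (x ∷ xs) n = begin
    ΣPS (map F (filterᵇ p (g x ++ concatMap g xs))) n
      ≡⟨ cong (λ ys → ΣPS (map F ys) n) (filterᵇ-++ p (g x) (concatMap g xs)) ⟩
    ΣPS (map F (filterᵇ p (g x) ++ filterᵇ p (concatMap g xs))) n
      ≡⟨ cong (λ ys → ΣPS ys n) (LP.map-++ F (filterᵇ p (g x)) (filterᵇ p (concatMap g xs))) ⟩
    ΣPS (map F (filterᵇ p (g x)) ++ map F (filterᵇ p (concatMap g xs))) n
      ≡⟨ ΣPS-++ (map F (filterᵇ p (g x))) (map F (filterᵇ p (concatMap g xs))) n ⟩
    ΣPS (map F (filterᵇ p (g x))) n ℤ.+ ΣPS (map F (filterᵇ p (concatMap g xs))) n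
      ≡⟨ cong (λ z → ΣPS (map F (filterᵇ p (g x))) n ℤ.+ z) (ΣPS-filter-concatMap F p g xs n) ⟩
    ΣPS (map (λ a → ΣPS (map F (filterᵇ p (g a)))) (x ∷ xs)) n ∎
    where open ≡-Reasoning

module SubPartitions where

  open PowerSeriesAlgebra
  open PowerSeriesRing
  open SubPartitionSeries
  open ListFacts
  open import Data.Bool using (Bool; _∧_)
  open import Data.Nat as ℕ using (ℕ; suc; s≤s; _⊓_; _≤ᵇ_)
  import Data.Nat.Properties as NP
  import Data.Integer.Properties as ZP
  open import Data.List using (List; []; _∷_; map; upTo; filterᵇ)
  open import Data.Vec as Vec using (Vec; toList)
  open import Function using (_∘_)
  open import Relation.Binary.PropositionalEquality using (_≡_; _≗_; refl; sym; trans; cong; subst)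
  open import Relation.Binary.Reasoning.Setoid powerSeriesSetoid
  open import Data.Sum using (inj₁; inj₂)
  open import Data.Empty using (⊥-elim)

  weight : ∀ {b} → Vec ℕ b → PowerSeries
  weight ν = monomial (Vec.sum ν)

  ΣPS-weight-∷ : ∀ {b} y (L : List (Vec ℕ b)) → ΣPS (map weight (map (y Vec.∷_) L)) ≗ (q y ⊛ ΣPS (map weight L))
  ΣPS-weight-∷ y []      = ≗-sym (⊛-zero (q y))
  ΣPS-weight-∷ y (ν ∷ L) = ≗-trans (⊕-cong (≗-sym (monomial-+ y (Vec.sum ν))) (ΣPS-weight-∷ y L))
                                    (≗-sym (⊛-distribˡ (weight ν) (ΣPS (map weight L)) (q y)))

  ΣPS-box-∷ : ∀ {b} l (λ′ : Vec ℕ b) (p : Vec ℕ (suc b) → Bool) →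
    ΣPS (map weight (filterᵇ p (box (l Vec.∷ λ′))))
      ≗ sumPS (suc l) (λ y → q y ⊛ ΣPS (map weight (filterᵇ (p ∘ (y Vec.∷_)) (box λ′))))
  ΣPS-box-∷ l λ′ p = begin
    ΣPS (map weight (filterᵇ p (box (l Vec.∷ λ′))))
      ≈⟨ ΣPS-filter-concatMap weight p (λ y → map (y Vec.∷_) (box λ′)) (upTo (suc l)) ⟩
    ΣPS (map (λ y → ΣPS (map weight (filterᵇ p (map (y Vec.∷_) (box λ′))))) (upTo (suc l)))
      ≈⟨ ΣPS-map-cong (upTo (suc l)) firstCoordinate ⟩
    ΣPS (map (λ y → q y ⊛ ΣPS (map weight (filterᵇ (p ∘ (y Vec.∷_)) (box λ′)))) (upTo (suc l)))
      ≈⟨ ΣPS-upTo (suc l) _ ⟩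
    sumPS (suc l) (λ y → q y ⊛ ΣPS (map weight (filterᵇ (p ∘ (y Vec.∷_)) (box λ′)))) ∎
    where
    firstCoordinate : ∀ y → ΣPS (map weight (filterᵇ p (map (y Vec.∷_) (box λ′))))
                              ≗ (q y ⊛ ΣPS (map weight (filterᵇ (p ∘ (y Vec.∷_)) (box λ′))))
    firstCoordinate y n = trans
      (cong (λ ys → ΣPS (map weight ys) n) (filterᵇ-map p (y Vec.∷_) (box λ′)))
      (ΣPS-weight-∷ y (filterᵇ (p ∘ (y Vec.∷_)) (box λ′)) n)

  Gcap-enum : ∀ {b} → ℕ → Vec ℕ b → PowerSeries
  Gcap-enum x μ = ΣPS (map weight (filterᵇ (λ ν → weaklyDecᵇ (x ∷ toList ν)) (box μ)))

  Gcap-enum≗Gcap : ∀ {b} x (μ : Vec ℕ b) → Gcap-enum x μ ≗ Gcap x (toList μ)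
  Gcap-enum≗Gcap x Vec.[] n = ZP.+-identityʳ _
  Gcap-enum≗Gcap {suc b} x (l Vec.∷ μ) = begin
    Gcap-enum x (l Vec.∷ μ)
      ≈⟨ ΣPS-box-∷ l μ (λ ν → weaklyDecᵇ (x ∷ toList ν)) ⟩
    sumPS (suc l) (λ y → q y ⊛ Tail y)
      ≈⟨ sumPS-truncate (suc l) (suc (x ⊓ l)) _ (s≤s (NP.m⊓n≤n x l)) (λ y xl<y y<l → aboveCap y xl<y (NP.≤-pred y<l)) ⟩
    sumPS (suc (x ⊓ l)) (λ y → q y ⊛ Tail y)
      ≈⟨ sumPS-cong (suc (x ⊓ l)) (λ y y<xl → belowCap y (NP.≤-trans (NP.≤-pred y<xl) (NP.m⊓n≤m x l))) ⟩
    sumPS (suc (x ⊓ l)) (λ y → q y ⊛ Gcap y (toList μ)) ∎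
    where
    -- ν = (y, ν′) is weakly decreasing with ν₁ ≤ x iff y ≤ x and (y, ν′) is weakly decreasing.
    Tail : ℕ → PowerSeries
    Tail y = ΣPS (map weight (filterᵇ (λ ν → (y ≤ᵇ x) ∧ weaklyDecᵇ (y ∷ toList ν)) (box μ)))
    aboveCap : ∀ y → suc (x ⊓ l) ℕ.≤ y → y ℕ.≤ l → (q y ⊛ Tail y) ≗ zeroPS
    aboveCap y xl<y y≤l = q⊛-vanishes y (λ n → cong (λ ys → ΣPS (map weight ys) n) noneLeft)
      where
      x<y : x ℕ.< y
      x<y with NP.≤-total x l
      ... | inj₁ x≤l = subst (ℕ._< y) (NP.m≤n⇒m⊓n≡m x≤l) xl<y
      ... | inj₂ l≤x = ⊥-elim (NP.<⇒≱ (subst (ℕ._< y) (NP.m≥n⇒m⊓n≡n l≤x) xl<y) y≤l)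
      noneLeft : filterᵇ (λ ν → (y ≤ᵇ x) ∧ weaklyDecᵇ (y ∷ toList ν)) (box μ) ≡ []
      noneLeft = filterᵇ-none _ (box μ) (λ ν → cong (_∧ weaklyDecᵇ (y ∷ toList ν)) (≤ᵇ-false x<y))
    belowCap : ∀ y → y ℕ.≤ x → (q y ⊛ Tail y) ≗ (q y ⊛ Gcap y (toList μ))
    belowCap y y≤x = ⊛-congˡ (q y) (≗-trans (λ n → cong (λ ys → ΣPS (map weight ys) n) capHolds) (Gcap-enum≗Gcap y μ))
      where
      capHolds : filterᵇ (λ ν → (y ≤ᵇ x) ∧ weaklyDecᵇ (y ∷ toList ν)) (box μ)
                 ≡ filterᵇ (λ ν → weaklyDecᵇ (y ∷ toList ν)) (box μ)
      capHolds rewrite ≤ᵇ-true y≤x = refl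

  G≗Gshift : ∀ {b} (λ′ : Vec ℕ b) → G λ′ ≗ Gshift 0 (toList λ′)
  G≗Gshift Vec.[] n = ZP.+-identityʳ _
  G≗Gshift (l Vec.∷ μ) = begin
    G (l Vec.∷ μ)
      ≈⟨ ΣPS-box-∷ l μ (λ ν → weaklyDecᵇ (toList ν)) ⟩
    sumPS (suc l) (λ y → q y ⊛ Gcap-enum y μ)
      ≈⟨ sumPS-cong (suc l) (λ y _ → ≗-trans (⊛-congʳ (Gcap-enum y μ) (q-cong (sym (NP.+-identityʳ y))))
                                              (⊛-congˡ (q (1 ℕ.* y)) (Gcap-enum≗Gcap y μ))) ⟩
    sumPS (suc l) (λ y → q (1 ℕ.* y) ⊛ Gcap y (toList μ)) ∎

-- Besides the
-- head-first enumeration of Defs we need the split according to the LAST coordinate,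
-- i.e. according to whether b+1 ∈ A for A ⊆ [b+1].
module Subsets where

  open PowerSeriesAlgebra
  open PowerSeriesRing
  open ListFacts using (filterᵇ-++; filterᵇ-cong)
  open import Data.Bool using (Bool; true; false; if_then_else_; T?)
  open import Data.Nat as ℕ using (ℕ; zero; suc; z≤n; s≤s)
  import Data.Nat.Properties as NP
  open import Data.Integer as ℤ using ()
  import Data.Integer.Properties as ZP
  open import Data.List using ([]; _∷_; map; applyUpTo; filterᵇ; concatMap; _++_; length)
  import Data.List.Properties as LP
  open import Data.List.Relation.Unary.All using (All; []; _∷_)
  import Data.List.Relation.Unary.All.Properties as AllP
  open import Data.Vec as Vec using (Vec; toList; _∷ʳ_)
  import Data.Vec.Properties as VP
  open import Data.Product using (_×_; _,_)
  open import Function using (_∘_)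
  open import Relation.Binary.PropositionalEquality

  ΣSubsets : ∀ b → (Vec Bool b → PowerSeries) → PowerSeries
  ΣSubsets zero    t = t Vec.[]
  ΣSubsets (suc b) t = ΣSubsets b (λ A → t (true Vec.∷ A)) ⊕ ΣSubsets b (λ A → t (false Vec.∷ A))

  ΣSubsets-cong : ∀ b {t t′ : Vec Bool b → PowerSeries} → (∀ A → t A ≗ t′ A) → ΣSubsets b t ≗ ΣSubsets b t′
  ΣSubsets-cong zero    h = h Vec.[]
  ΣSubsets-cong (suc b) h = ⊕-cong (ΣSubsets-cong b (h ∘ (true Vec.∷_))) (ΣSubsets-cong b (h ∘ (false Vec.∷_)))

  interchange : ∀ a b c d → ((a ⊕ b) ⊕ (c ⊕ d)) ≗ ((a ⊕ c) ⊕ (b ⊕ d))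
  interchange = solve 4 (λ a b c d → ((a :+ b) :+ (c :+ d)) := ((a :+ c) :+ (b :+ d))) ≗-refl

  ΣSubsets-⊕ : ∀ b (t s : Vec Bool b → PowerSeries) → ΣSubsets b (λ A → t A ⊕ s A) ≗ (ΣSubsets b t ⊕ ΣSubsets b s)
  ΣSubsets-⊕ zero    t s = ≗-refl
  ΣSubsets-⊕ (suc b) t s =
    ≗-trans (⊕-cong (ΣSubsets-⊕ b (t ∘ (true Vec.∷_)) (s ∘ (true Vec.∷_)))
                    (ΣSubsets-⊕ b (t ∘ (false Vec.∷_)) (s ∘ (false Vec.∷_))))
            (interchange (ΣSubsets b (t ∘ (true Vec.∷_))) (ΣSubsets b (s ∘ (true Vec.∷_)))
                         (ΣSubsets b (t ∘ (false Vec.∷_))) (ΣSubsets b (s ∘ (false Vec.∷_))))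

  ΣSubsets-neg-⊛ : ∀ b c (t : Vec Bool b → PowerSeries) → ΣSubsets b (λ A → negPS (c ⊛ t A)) ≗ negPS (c ⊛ ΣSubsets b t)
  ΣSubsets-neg-⊛ zero    c t = ≗-refl
  ΣSubsets-neg-⊛ (suc b) c t =
    ≗-trans (⊕-cong (ΣSubsets-neg-⊛ b c (t ∘ (true Vec.∷_))) (ΣSubsets-neg-⊛ b c (t ∘ (false Vec.∷_))))
            (linear c (ΣSubsets b (t ∘ (true Vec.∷_))) (ΣSubsets b (t ∘ (false Vec.∷_))))
    where
    linear : ∀ c x y → (negPS (c ⊛ x) ⊕ negPS (c ⊛ y)) ≗ negPS (c ⊛ (x ⊕ y))
    linear = solve 3 (λ c x y → ((:- (c :* x)) :+ (:- (c :* y))) := (:- (c :* (x :+ y)))) ≗-refl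

  ΣSubsets-∷ʳ : ∀ b (t : Vec Bool (suc b) → PowerSeries) →
    ΣSubsets (suc b) t ≗ (ΣSubsets b (λ A → t (A ∷ʳ true)) ⊕ ΣSubsets b (λ A → t (A ∷ʳ false)))
  ΣSubsets-∷ʳ zero    t = ≗-refl
  ΣSubsets-∷ʳ (suc b) t =
    ≗-trans (⊕-cong (ΣSubsets-∷ʳ b (t ∘ (true Vec.∷_))) (ΣSubsets-∷ʳ b (t ∘ (false Vec.∷_))))
            (interchange (ΣSubsets b (λ A → t (true Vec.∷ (A ∷ʳ true)))) (ΣSubsets b (λ A → t (true Vec.∷ (A ∷ʳ false))))
                         (ΣSubsets b (λ A → t (false Vec.∷ (A ∷ʳ true)))) (ΣSubsets b (λ A → t (false Vec.∷ (A ∷ʳ false)))))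

  ΣPS-allSubsets : ∀ b (t : Vec Bool b → PowerSeries) → ΣPS (map t (allSubsets b)) ≗ ΣSubsets b t
  ΣPS-allSubsets zero    t n = ZP.+-identityʳ _
  ΣPS-allSubsets (suc b) t =
    ≗-trans (pairUp (allSubsets b))
            (≗-trans (ΣPS-allSubsets b (λ A → t (true Vec.∷ A) ⊕ t (false Vec.∷ A)))
                     (ΣSubsets-⊕ b (t ∘ (true Vec.∷_)) (t ∘ (false Vec.∷_))))
    where
    pairUp : ∀ As → ΣPS (map t (concatMap (λ A → (true Vec.∷ A) ∷ (false Vec.∷ A) ∷ []) As))
                    ≗ ΣPS (map (λ A → t (true Vec.∷ A) ⊕ t (false Vec.∷ A)) As)
    pairUp []       = ≗-refl
    pairUp (A ∷ As) n = trans (sym (ZP.+-assoc (t (true Vec.∷ A) n) (t (false Vec.∷ A) n) _))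
                              (cong (λ z → t (true Vec.∷ A) n ℤ.+ t (false Vec.∷ A) n ℤ.+ z) (pairUp As n))

  InRange : ℕ → ℕ → Set
  InRange b i = 1 ℕ.≤ i × i ℕ.≤ b

  range≡applyUpTo : ∀ n → range n ≡ applyUpTo suc n
  range≡applyUpTo n = LP.map-upTo suc n

  range-InRange : ∀ b → All (InRange b) (range b)
  range-InRange b = subst (All (InRange b)) (sym (range≡applyUpTo b)) (AllP.applyUpTo⁺₁ suc b (λ i<b → s≤s z≤n , i<b))

  elems-InRange : ∀ {b} (A : Vec Bool b) → All (InRange b) (elems A)
  elems-InRange {b} A = AllP.filter⁺ (T? ∘ nthD false (toList A)) (range-InRange b)

  range-+ : ∀ m n → range (m ℕ.+ n) ≡ range m ++ applyUpTo (λ i → suc (m ℕ.+ i)) n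
  range-+ m n = trans (range≡applyUpTo (m ℕ.+ n))
                      (trans (applyUpTo-+ suc m n) (cong (_++ applyUpTo (λ i → suc (m ℕ.+ i)) n) (sym (range≡applyUpTo m))))
    where
    applyUpTo-+ : ∀ {X : Set} (f : ℕ → X) m n → applyUpTo f (m ℕ.+ n) ≡ applyUpTo f m ++ applyUpTo (λ i → f (m ℕ.+ i)) n
    applyUpTo-+ f zero    n = refl
    applyUpTo-+ f (suc m) n = cong (f 0 ∷_) (applyUpTo-+ (f ∘ suc) m n)

  range-snoc : ∀ b → range (suc b) ≡ range b ++ (suc b ∷ [])
  range-snoc b = trans (cong range (NP.+-comm 1 b)) (trans (range-+ b 1) (cong (λ x → range b ++ (suc x ∷ [])) (NP.+-identityʳ b)))

  nthD-++-< : ∀ {X : Set} (d : X) xs y i → 1 ℕ.≤ i → i ℕ.≤ length xs → nthD d (xs ++ (y ∷ [])) i ≡ nthD d xs i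
  nthD-++-< d (x ∷ xs) y (suc zero)    _ _        = refl
  nthD-++-< d (x ∷ xs) y (suc (suc j)) _ (s≤s le) = nthD-++-< d xs y (suc j) (s≤s z≤n) le

  nthD-++-last : ∀ {X : Set} (d : X) xs y → nthD d (xs ++ (y ∷ [])) (suc (length xs)) ≡ y
  nthD-++-last d []           y = refl
  nthD-++-last d (x ∷ [])     y = refl
  nthD-++-last d (x ∷ x′ ∷ xs) y = nthD-++-last d (x′ ∷ xs) y

  elems-∷ʳ : ∀ {b} (A : Vec Bool b) x → elems (A ∷ʳ x) ≡ elems A ++ (if x then suc b ∷ [] else [])
  elems-∷ʳ {b} A x = begin
    filterᵇ member′ (range (suc b))                                  ≡⟨ cong (filterᵇ member′) (range-snoc b) ⟩
    filterᵇ member′ (range b ++ (suc b ∷ []))                        ≡⟨ filterᵇ-++ member′ (range b) (suc b ∷ []) ⟩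
    filterᵇ member′ (range b) ++ filterᵇ member′ (suc b ∷ [])        ≡⟨ cong₂ _++_ oldElements newElement ⟩
    filterᵇ member (range b) ++ (if x then suc b ∷ [] else [])       ∎
    where
    open ≡-Reasoning
    member member′ : ℕ → Bool
    member  = nthD false (toList A)
    member′ = nthD false (toList (A ∷ʳ x))
    toList′ : toList (A ∷ʳ x) ≡ toList A ++ (x ∷ [])
    toList′ = VP.toList-∷ʳ x A
    unchanged : ∀ i → InRange b i → member′ i ≡ member i
    unchanged i (1≤i , i≤b) = trans (cong (λ xs → nthD false xs i) toList′)
      (nthD-++-< false (toList A) x i 1≤i (subst (i ℕ.≤_) (sym (VP.length-toList A)) i≤b))
    oldElements : filterᵇ member′ (range b) ≡ filterᵇ member (range b)
    oldElements = filterᵇ-cong member′ member (range b) (range-InRange b) unchanged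
    last : member′ (suc b) ≡ x
    last = trans (cong (λ xs → nthD false xs (suc b)) toList′)
      (subst (λ m → nthD false (toList A ++ (x ∷ [])) (suc m) ≡ x) (VP.length-toList A) (nthD-++-last false (toList A) x))
    newElement : filterᵇ member′ (suc b ∷ []) ≡ (if x then suc b ∷ [] else [])
    newElement with member′ (suc b) | last
    ... | true  | refl = refl
    ... | false | refl = refl

module CoefficientFunctions where

  open ListFacts using (≤ᵇ-true; ≤ᵇ-false; filterᵇ-++; filterᵇ-all)
  open Subsets using (InRange)
  open import Data.Bool using (true; false; if_then_else_; T?)
  open import Data.Nat as ℕ using (ℕ; suc; _∸_; _≤ᵇ_; _⊔_; _⊓_)
  import Data.Nat.Properties as NP
  open import Data.List using (List; []; _∷_; foldr; filterᵇ; _++_; [_])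
  import Data.List.Properties as LP
  open import Data.List.Relation.Unary.All as All using (All; []; _∷_)
  import Data.List.Relation.Unary.All.Properties as AllP
  open import Data.Vec as Vec using (Vec)
  open import Data.Product using (_,_; proj₁; proj₂)
  open import Relation.Binary.PropositionalEquality hiding ([_])

  upTo≤ : List ℕ → ℕ → List ℕ
  upTo≤ E k = filterᵇ (λ i → i ≤ᵇ k) E

  fList : ∀ {b} → Vec ℕ b → List ℕ → ℕ → ℕ
  fList     la []       k = 0
  fList {b} la (x ∷ xs) k = if minNE x xs ≤ᵇ k then part la (suc b ∸ maxC (upTo≤ (x ∷ xs) k)) ℕ.+ 1 else 0

  gList : List ℕ → ℕ → ℕ
  gList E k = k ∸ maxC (upTo≤ E k) ℕ.+ 1

  fA≡fList : ∀ {b} (la : Vec ℕ b) A k → fA la A k ≡ fList la (elems A) k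
  fA≡fList {b} la A k with elems A in eq
  ... | []     = refl
  ... | x ∷ xs = cong (λ E → if minNE x xs ≤ᵇ k then part la (suc b ∸ maxC (upTo≤ E k)) ℕ.+ 1 else 0) eq

  maxC-InRange : ∀ {b} E → 1 ℕ.≤ b → All (InRange b) E → InRange b (maxC E)
  maxC-InRange []       1≤b []         = NP.≤-refl , 1≤b
  maxC-InRange (x ∷ xs) 1≤b (ix ∷ ixs) = foldr-⊔ x xs ix ixs
    where
    foldr-⊔ : ∀ {b} x xs → InRange b x → All (InRange b) xs → InRange b (foldr _⊔_ x xs)
    foldr-⊔ x []       ix []         = ix
    foldr-⊔ x (y ∷ ys) ix ((1≤y , y≤b) ∷ iys) with foldr-⊔ x ys ix iys
    ... | (1≤m , m≤b) = NP.≤-trans 1≤y (NP.m≤m⊔n _ _) , NP.⊔-lub y≤b m≤b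

  maxC-++-top : ∀ E y → All (ℕ._≤ y) E → maxC (E ++ [ y ]) ≡ y
  maxC-++-top []       y h = refl
  maxC-++-top (x ∷ xs) y (x≤y ∷ h) =
    trans (LP.foldr-++ _⊔_ x xs [ y ]) (trans (cong (λ z → foldr _⊔_ z xs) (NP.m≥n⇒m⊔n≡m x≤y)) (foldr-⊔-top xs h))
    where
    foldr-⊔-top : ∀ xs → All (ℕ._≤ y) xs → foldr _⊔_ y xs ≡ y
    foldr-⊔-top []       []        = refl
    foldr-⊔-top (x ∷ xs) (x≤y ∷ h) = trans (cong (x ⊔_) (foldr-⊔-top xs h)) (NP.m≤n⇒m⊔n≡n x≤y)

  minNE-++-top : ∀ x xs y → x ℕ.≤ y → minNE x (xs ++ [ y ]) ≡ minNE x xs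
  minNE-++-top x xs y x≤y = trans (LP.foldr-++ _⊓_ x xs [ y ]) (cong (λ z → foldr _⊓_ z xs) (NP.m≥n⇒m⊓n≡n x≤y))

  minNE-≤ : ∀ x xs → minNE x xs ℕ.≤ x
  minNE-≤ x []       = NP.≤-refl
  minNE-≤ x (y ∷ ys) = NP.≤-trans (NP.m⊓n≤n y _) (minNE-≤ x ys)

  upTo≤-++-> : ∀ E y k → k ℕ.< y → upTo≤ (E ++ [ y ]) k ≡ upTo≤ E k
  upTo≤-++-> E y k k<y rewrite filterᵇ-++ (λ i → i ≤ᵇ k) E [ y ] | ≤ᵇ-false k<y = LP.++-identityʳ _

  upTo≤-++-≤ : ∀ E y k → y ℕ.≤ k → All (ℕ._≤ y) E → upTo≤ (E ++ [ y ]) k ≡ E ++ [ y ]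
  upTo≤-++-≤ E y k y≤k h =
    filterᵇ-all _ (E ++ [ y ]) (All.map (λ i≤y → ≤ᵇ-true (NP.≤-trans i≤y y≤k)) (AllP.++⁺ h (NP.≤-refl ∷ [])))

  -- Giving λ a new first part does not change f on subsets of [b] (indices shift by one).
  fList-∷ : ∀ {b} l (la : Vec ℕ b) E k → All (InRange b) E → fList (l Vec.∷ la) E k ≡ fList la E k
  fList-∷ l la [] k _ = refl
  fList-∷ {b} l la (x ∷ xs) k (ix ∷ ixs) with minNE x xs ≤ᵇ k
  ... | false = refl
  ... | true  = cong (ℕ._+ 1) (shiftIndex (maxC-InRange (upTo≤ (x ∷ xs) k) (NP.≤-trans (proj₁ ix) (proj₂ ix))
                                                       (AllP.filter⁺ (λ i → T? (i ≤ᵇ k)) (ix ∷ ixs))))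
    where
    shiftIndex : ∀ {M} → InRange b M → part (l Vec.∷ la) (suc (suc b) ∸ M) ≡ part la (suc b ∸ M)
    shiftIndex (1≤M , M≤b) rewrite NP.+-∸-assoc 1 (NP.≤-trans M≤b (NP.n≤1+n b)) | NP.+-∸-assoc 1 M≤b = refl

  fList-++-> : ∀ {b} (la : Vec ℕ b) E y k → k ℕ.< y → All (ℕ._≤ y) E → fList la (E ++ [ y ]) k ≡ fList la E k
  fList-++-> la [] y k k<y _ rewrite ≤ᵇ-false k<y = refl
  fList-++-> {b} la (x ∷ xs) y k k<y (x≤y ∷ _) =
    cong₂ (λ m F → if m ≤ᵇ k then part la (suc b ∸ maxC F) ℕ.+ 1 else 0) (minNE-++-top x xs y x≤y) (upTo≤-++-> (x ∷ xs) y k k<y)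

  fList-++-≤ : ∀ {b} (la : Vec ℕ b) E y k → y ℕ.≤ k → All (ℕ._≤ y) E → fList la (E ++ [ y ]) k ≡ part la (suc b ∸ y) ℕ.+ 1
  fList-++-≤ la [] y k y≤k _ rewrite ≤ᵇ-true y≤k = refl
  fList-++-≤ {b} la (x ∷ xs) y k y≤k (x≤y ∷ h)
    rewrite ≤ᵇ-true (NP.≤-trans (minNE-≤ x (xs ++ [ y ])) (NP.≤-trans x≤y y≤k))
          | upTo≤-++-≤ (x ∷ xs) y k y≤k (x≤y ∷ h)
          | maxC-++-top (x ∷ xs) y (x≤y ∷ h) = refl

  gList-++-> : ∀ E y k → k ℕ.< y → gList (E ++ [ y ]) k ≡ gList E k
  gList-++-> E y k k<y = cong (λ F → k ∸ maxC F ℕ.+ 1) (upTo≤-++-> E y k k<y)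

  gList-++-≤ : ∀ E y k → y ℕ.≤ k → All (ℕ._≤ y) E → gList (E ++ [ y ]) k ≡ k ∸ y ℕ.+ 1
  gList-++-≤ E y k y≤k h =
    trans (cong (λ F → k ∸ maxC F ℕ.+ 1) (upTo≤-++-≤ E y k y≤k h)) (cong (λ m → k ∸ m ℕ.+ 1) (maxC-++-top E y h))

module ShiftedRightHandSide where

  open PowerSeriesAlgebra
  open PowerSeriesRing
  open Geometric using (geometric-inverse)
  open SubPartitionSeries
  open ListFacts using (applyUpTo-cong; sum-applyUpTo-const; ΠPS-++)
  open Subsets
  open CoefficientFunctions
  open import Data.Bool using (Bool; true; false)
  open import Data.Nat as ℕ using (ℕ; zero; suc; _∸_; z≤n; s≤s; _*_)
  import Data.Nat.Properties as NP
  open import Data.Integer as ℤ using ()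
  import Data.Integer.Properties as ZP
  open import Data.List using (List; []; _∷_; map; foldr; applyUpTo; _++_; [_]; length)
  open import Data.Nat.ListAction using (sum)
  open import Data.Nat.ListAction.Properties using (sum-++)
  import Data.List.Properties as LP
  open import Data.List.Relation.Unary.All as All using (All; []; _∷_)
  open import Data.Vec as Vec using (Vec; toList; _∷ʳ_)
  open import Data.Fin as Fin using (Fin)
  open import Data.Unit using (tt)
  open import Data.Product using (_,_; proj₁; proj₂)
  open import Function using (_∘_)
  open import Relation.Binary.PropositionalEquality hiding ([_])
  import Relation.Binary.Reasoning.Setoid powerSeriesSetoid as ≗-Reasoning

  term : ∀ {b} → List ℕ → Vec ℕ b → List ℕ → PowerSeries
  term R la E = scale (sign (length E)) (monomial (sum (map (fList la E) R)) ⊛ ΠPS (map (λ k → geometric (gList E k)) R))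

  term-range : ∀ {b R R′} (la : Vec ℕ b) E → R ≡ R′ → term R la E ≗ term R′ la E
  term-range la E refl = ≗-refl

  W : ∀ {b} → ℕ → Vec ℕ b → PowerSeries
  W {b} d la = ΣSubsets b (λ A → term (range (b ℕ.+ d)) la (elems A))

  P : ℕ → PowerSeries
  P d = ΠPS (map geometric (range d))

  RHS≗W : ∀ {b} (la : Vec ℕ b) → RHS la ≗ W 0 la
  RHS≗W {b} la = ≗-trans (ΣPS-allSubsets b rhsTerm) (ΣSubsets-cong b viaElements)
    where
    rhsTerm : Vec Bool b → PowerSeries
    rhsTerm A = scale (sign (card A)) (monomial (foldr ℕ._+_ 0 (map (fA la A) (range b)))
                                        ⊛ ΠPS (map (λ k → geometric (gA A k)) (range b)))
    viaElements : ∀ A → rhsTerm A ≗ term (range (b ℕ.+ 0)) la (elems A)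
    viaElements A = ≗-trans fViaElements (term-range la (elems A) (cong range (sym (NP.+-identityʳ b))))
      where
      fViaElements : rhsTerm A ≗ term (range b) la (elems A)
      fViaElements n =
        cong (λ fs → scale (sign (card A)) (monomial (sum fs) ⊛ ΠPS (map (λ k → geometric (gA A k)) (range b))) n)
             (LP.map-cong (fA≡fList la A) (range b))

  P-suc : ∀ d → P (suc d) ≗ (P d ⊛ geometric (suc d))
  P-suc d = begin
    ΠPS (map geometric (range (suc d)))                    ≈⟨ (λ n → cong (λ ks → ΠPS (map geometric ks) n) (range-snoc d)) ⟩
    ΠPS (map geometric (range d ++ [ suc d ]))             ≈⟨ (λ n → cong (λ gs → ΠPS gs n) (LP.map-++ geometric (range d) [ suc d ])) ⟩
    ΠPS (map geometric (range d) ++ [ geometric (suc d) ]) ≈⟨ ΠPS-++ (map geometric (range d)) [ geometric (suc d) ] ⟩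
    P d ⊛ (geometric (suc d) ⊛ onePS)                      ≈⟨ ⊛-congˡ (P d) (⊛-one (geometric (suc d))) ⟩
    P d ⊛ geometric (suc d)                                ∎
    where open ≗-Reasoning

  -- For λ = () only A = ∅ occurs, with f = 0 and g(k) = k.
  W-[] : ∀ d → W d Vec.[] ≗ P d
  W-[] d = begin
    scale ℤ.1ℤ (monomial (sum (map (λ _ → 0) (range d))) ⊛ Πg)  ≈⟨ (λ n → ZP.*-identityˡ _) ⟩
    monomial (sum (map (λ _ → 0) (range d))) ⊛ Πg               ≈⟨ ⊛-congʳ Πg (q-cong (sumZero (range d))) ⟩
    onePS ⊛ Πg                                                  ≈⟨ one-⊛ Πg ⟩
    Πg                                                          ≈⟨ (λ n → cong (λ gs → ΠPS gs n) (LP.map-cong-local gₖ≡k)) ⟩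
    P d                                                         ∎
    where
    open ≗-Reasoning
    Πg = ΠPS (map (λ k → geometric (k ∸ 1 ℕ.+ 1)) (range d))
    sumZero : ∀ (ks : List ℕ) → sum (map (λ _ → 0) ks) ≡ 0
    sumZero []       = refl
    sumZero (_ ∷ ks) = sumZero ks
    gₖ≡k : All (λ k → geometric (k ∸ 1 ℕ.+ 1) ≡ geometric k) (range d)
    gₖ≡k = All.map (λ ik → cong geometric (NP.m∸n+n≡m (proj₁ ik))) (range-InRange d)

  -- Subsets E ⊆ [b] do not see a new first part l of λ (f only reads λ_{b+1-max}, shifted by one).
  term-∷ : ∀ {b} R l (la : Vec ℕ b) E → All (InRange b) E → term R (l Vec.∷ la) E ≗ term R la E
  term-∷ R l la E h n =
    cong (λ fs → scale (sign (length E)) (monomial (sum fs) ⊛ ΠPS (map (λ k → geometric (gList E k)) R)) n)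
         (LP.map-cong (λ k → fList-∷ l la E k h) R)

  -- For subsets containing b+1, the range [b+1+d] of k splits into [b] and the block
  -- T = (b+1, …, b+1+d), on which every k exceeds all elements of E ⊆ [b].
  module AppendTop {b} (d l : ℕ) (la : Vec ℕ b) (E : List ℕ) (E⊆[b] : All (InRange b) E) where

    E′ : List ℕ
    E′ = E ++ [ suc b ]

    T : List ℕ
    T = applyUpTo (λ i → suc (b ℕ.+ i)) (suc d)

    range-split : range (suc b ℕ.+ d) ≡ range b ++ T
    range-split = trans (cong range (sym (NP.+-suc b d))) (range-+ b (suc d))

    E≤b+1 : All (ℕ._≤ suc b) E
    E≤b+1 = All.map (λ ik → NP.≤-trans (proj₂ ik) (NP.n≤1+n b)) E⊆[b]

    -- On T, f(k) = λ'_1 + 1 = l + 1 where λ' = (l, λ); summing gives (d+1)(l+1).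
    Σf-T : sum (map (fList (l Vec.∷ la) E′) T) ≡ suc d * suc l
    Σf-T = begin
      sum (map (fList (l Vec.∷ la) E′) T)
        ≡⟨ cong sum (LP.map-applyUpTo (λ i → suc (b ℕ.+ i)) (fList (l Vec.∷ la) E′) (suc d)) ⟩
      sum (applyUpTo (λ i → fList (l Vec.∷ la) E′ (suc (b ℕ.+ i))) (suc d)) ≡⟨ cong sum (applyUpTo-cong (suc d) fOnT) ⟩
      sum (applyUpTo (λ _ → suc l) (suc d))                        ≡⟨ sum-applyUpTo-const (suc l) (suc d) ⟩
      suc d * suc l                                                ∎
      where
      open ≡-Reasoning
      fOnT : ∀ i → fList (l Vec.∷ la) E′ (suc (b ℕ.+ i)) ≡ suc l
      fOnT i = trans (fList-++-≤ (l Vec.∷ la) E (suc b) (suc (b ℕ.+ i)) (s≤s (NP.m≤m+n b i)) E≤b+1)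
                     (trans (cong (λ m → part (l Vec.∷ la) m ℕ.+ 1) (NP.m+n∸n≡m 1 b)) (NP.+-comm l 1))

    Σf : sum (map (fList (l Vec.∷ la) E′) (range (suc b ℕ.+ d))) ≡ sum (map (fList la E) (range b)) ℕ.+ suc d * suc l
    Σf = trans (cong (sum ∘ map (fList (l Vec.∷ la) E′)) range-split)
         (trans (cong sum (LP.map-++ (fList (l Vec.∷ la) E′) (range b) T))
         (trans (sum-++ (map (fList (l Vec.∷ la) E′) (range b)) (map (fList (l Vec.∷ la) E′) T))
                (cong₂ ℕ._+_ (cong sum (LP.map-cong-local (All.map fBelow (range-InRange b)))) Σf-T)))
      where
      fBelow : ∀ {k} → InRange b k → fList (l Vec.∷ la) E′ k ≡ fList la E k
      fBelow {k} ik = trans (fList-++-> (l Vec.∷ la) E (suc b) k (s≤s (proj₂ ik)) E≤b+1) (fList-∷ l la E k E⊆[b])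

    -- On T, g(b+1+i) = i+1, producing the factor P (d+1).
    g-T : map (λ k → geometric (gList E′ k)) T ≡ map geometric (range (suc d))
    g-T = begin
      map (λ k → geometric (gList E′ k)) T                           ≡⟨ LP.map-applyUpTo (λ i → suc (b ℕ.+ i)) _ (suc d) ⟩
      applyUpTo (λ i → geometric (gList E′ (suc (b ℕ.+ i)))) (suc d)  ≡⟨ applyUpTo-cong (suc d) (cong geometric ∘ gOnT) ⟩
      applyUpTo (geometric ∘ suc) (suc d)                            ≡⟨ sym (LP.map-applyUpTo suc geometric (suc d)) ⟩
      map geometric (applyUpTo suc (suc d))                          ≡⟨ cong (map geometric) (sym (range≡applyUpTo (suc d))) ⟩
      map geometric (range (suc d))                                  ∎
      where
      open ≡-Reasoning
      gOnT : ∀ i → gList E′ (suc (b ℕ.+ i)) ≡ suc i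
      gOnT i = trans (gList-++-≤ E (suc b) (suc (b ℕ.+ i)) (s≤s (NP.m≤m+n b i)) E≤b+1)
                     (trans (cong (ℕ._+ 1) (NP.m+n∸m≡n b i)) (NP.+-comm i 1))

    Πg : ΠPS (map (λ k → geometric (gList E′ k)) (range (suc b ℕ.+ d)))
         ≗ (ΠPS (map (λ k → geometric (gList E k)) (range b)) ⊛ P (suc d))
    Πg = begin
      ΠPS (map g′ (range (suc b ℕ.+ d)))       ≈⟨ (λ n → cong (λ ks → ΠPS (map g′ ks) n) range-split) ⟩
      ΠPS (map g′ (range b ++ T))              ≈⟨ (λ n → cong (λ gs → ΠPS gs n) (LP.map-++ g′ (range b) T)) ⟩
      ΠPS (map g′ (range b) ++ map g′ T)       ≈⟨ ΠPS-++ (map g′ (range b)) (map g′ T) ⟩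
      ΠPS (map g′ (range b)) ⊛ ΠPS (map g′ T)  ≈⟨ (λ n → cong₂ (λ xs ys → (ΠPS xs ⊛ ΠPS ys) n) gBelow g-T) ⟩
      ΠPS (map (λ k → geometric (gList E k)) (range b)) ⊛ P (suc d) ∎
      where
      open ≗-Reasoning
      g′ = λ k → geometric (gList E′ k)
      gBelow : map g′ (range b) ≡ map (λ k → geometric (gList E k)) (range b)
      gBelow = LP.map-cong-local (All.map (λ ik → cong geometric (gList-++-> E (suc b) _ (s≤s (proj₂ ik)))) (range-InRange b))

    term-append-top : term (range (suc b ℕ.+ d)) (l Vec.∷ la) E′
                      ≗ negPS ((q (suc d * suc l) ⊛ P (suc d)) ⊛ term (range b) la E)
    term-append-top n = begin
      sign (length E′) ℤ.* (q (sum (map (fList (l Vec.∷ la) E′) R′)) ⊛ ΠPS (map (λ k → geometric (gList E′ k)) R′)) n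
        ≡⟨ cong₂ ℤ._*_ (cong sign length-E′) (⊛-cong (q-cong Σf) Πg n) ⟩
      sign (suc (length E)) ℤ.* (q (S ℕ.+ e) ⊛ (Π ⊛ P (suc d))) n
        ≡⟨ cong (sign (suc (length E)) ℤ.*_) (regroup n) ⟩
      ℤ.- sign (length E) ℤ.* ((q e ⊛ P (suc d)) ⊛ (q S ⊛ Π)) n
        ≡⟨ sym (ZP.neg-distribˡ-* (sign (length E)) _) ⟩
      ℤ.- (sign (length E) ℤ.* ((q e ⊛ P (suc d)) ⊛ (q S ⊛ Π)) n)
        ≡⟨ cong ℤ.-_ (sym (⊛-scale (sign (length E)) (q e ⊛ P (suc d)) (q S ⊛ Π) n)) ⟩
      negPS ((q e ⊛ P (suc d)) ⊛ term (range b) la E) n ∎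
      where
      open ≡-Reasoning
      R′ = range (suc b ℕ.+ d)
      e  = suc d * suc l
      S  = sum (map (fList la E) (range b))
      Π  = ΠPS (map (λ k → geometric (gList E k)) (range b))
      length-E′ : length E′ ≡ suc (length E)
      length-E′ = trans (LP.length-++ E) (NP.+-comm (length E) 1)
      regroup : (q (S ℕ.+ e) ⊛ (Π ⊛ P (suc d))) ≗ ((q e ⊛ P (suc d)) ⊛ (q S ⊛ Π))
      regroup = ≗-trans (⊛-congʳ (Π ⊛ P (suc d)) (≗-sym (monomial-+ S e)))
                        (solve 4 (λ a b c d′ → ((a :* b) :* (c :* d′)) := ((b :* d′) :* (a :* c))) ≗-refl (q S) (q e) Π (P (suc d)))

  W-∷ : ∀ {b} d l (la : Vec ℕ b) → W d (l Vec.∷ la) ≗ (W (suc d) la ⊕ negPS (q (suc d * suc l) ⊛ (P (suc d) ⊛ W 0 la)))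
  W-∷ {b} d l la = begin
    W d (l Vec.∷ la)
      ≈⟨ ΣSubsets-∷ʳ b (λ A → term R (l Vec.∷ la) (elems A)) ⟩
    ΣSubsets b (λ A → term R (l Vec.∷ la) (elems (A ∷ʳ true))) ⊕ ΣSubsets b (λ A → term R (l Vec.∷ la) (elems (A ∷ʳ false)))
      ≈⟨ ⊕-cong withTop withoutTop ⟩
    negPS (Q ⊛ (P (suc d) ⊛ W 0 la)) ⊕ W (suc d) la
      ≈⟨ (λ n → ZP.+-comm (negPS (Q ⊛ (P (suc d) ⊛ W 0 la)) n) (W (suc d) la n)) ⟩
    W (suc d) la ⊕ negPS (Q ⊛ (P (suc d) ⊛ W 0 la)) ∎
    where
    open ≗-Reasoning
    R = range (suc b ℕ.+ d)
    Q = q (suc d * suc l)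
    range-b+0 : range b ≡ range (b ℕ.+ 0)
    range-b+0 = cong range (sym (NP.+-identityʳ b))
    withTop : ΣSubsets b (λ A → term R (l Vec.∷ la) (elems (A ∷ʳ true))) ≗ negPS (Q ⊛ (P (suc d) ⊛ W 0 la))
    withTop = begin
      ΣSubsets b (λ A → term R (l Vec.∷ la) (elems (A ∷ʳ true)))
        ≈⟨ ΣSubsets-cong b (λ A → ≗-trans (λ n → cong (λ E → term R (l Vec.∷ la) E n) (elems-∷ʳ A true))
                                           (AppendTop.term-append-top d l la (elems A) (elems-InRange A))) ⟩
      ΣSubsets b (λ A → negPS ((Q ⊛ P (suc d)) ⊛ term (range b) la (elems A)))
        ≈⟨ ΣSubsets-neg-⊛ b (Q ⊛ P (suc d)) (λ A → term (range b) la (elems A)) ⟩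
      negPS ((Q ⊛ P (suc d)) ⊛ ΣSubsets b (λ A → term (range b) la (elems A)))
        ≈⟨ negPS-cong (⊛-congˡ (Q ⊛ P (suc d)) (ΣSubsets-cong b (λ A → term-range la (elems A) range-b+0))) ⟩
      negPS ((Q ⊛ P (suc d)) ⊛ W 0 la)
        ≈⟨ negPS-cong (⊛-assoc Q (P (suc d)) (W 0 la)) ⟩
      negPS (Q ⊛ (P (suc d) ⊛ W 0 la)) ∎
    withoutTop : ΣSubsets b (λ A → term R (l Vec.∷ la) (elems (A ∷ʳ false))) ≗ W (suc d) la
    withoutTop = ΣSubsets-cong b (λ A →
      ≗-trans (λ n → cong (λ E → term R (l Vec.∷ la) E n) (trans (elems-∷ʳ A false) (LP.++-identityʳ (elems A))))
      (≗-trans (term-∷ R l la (elems A) (elems-InRange A))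
               (term-range la (elems A) (cong range (sym (NP.+-suc b d))))))

  W≗P⊛Gshift : ∀ {b} d (la : Vec ℕ b) → WeaklyDecreasing (toList la) → W d la ≗ (P d ⊛ Gshift d (toList la))
  W≗P⊛Gshift d Vec.[] _ = ≗-trans (W-[] d) (≗-sym (⊛-one (P d)))
  W≗P⊛Gshift d (l Vec.∷ la) (l≥la , decreasing) = begin
    W d (l Vec.∷ la)
      ≈⟨ W-∷ d l la ⟩
    W (suc d) la ⊕ negPS (Q ⊛ (P (suc d) ⊛ W 0 la))
      ≈⟨ ⊕-cong (IH (suc d)) (negPS-cong (⊛-congˡ Q (⊛-congˡ (P (suc d)) W0≗Gcap))) ⟩
    (P (suc d) ⊛ Gshift (suc d) μ) ⊕ negPS (Q ⊛ (P (suc d) ⊛ Gcap l μ))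
      ≈⟨ factor (P (suc d)) (Gshift (suc d) μ) (Gcap l μ) Q ⟩
    P (suc d) ⊛ (Gshift (suc d) μ ⊕ negPS (Q ⊛ Gcap l μ))
      ≈⟨ ⊛-cong (P-suc d) (≗-sym (Gshift-recursion d l μ l≥la)) ⟩
    (P d ⊛ geometric (suc d)) ⊛ (K ⊕ negPS (q (suc d) ⊛ K))
      ≈⟨ factor′ (P d) (geometric (suc d)) K (q (suc d)) ⟩
    P d ⊛ ((geometric (suc d) ⊕ negPS (q (suc d) ⊛ geometric (suc d))) ⊛ K)
      ≈⟨ ⊛-congˡ (P d) (≗-trans (⊛-congʳ K (geometric-inverse (suc d) (s≤s z≤n))) (one-⊛ K)) ⟩
    P d ⊛ K ∎
    where
    open ≗-Reasoning
    μ = toList la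
    Q = q (suc d * suc l)
    K = Gshift d (l ∷ μ)
    IH : ∀ d′ → W d′ la ≗ (P d′ ⊛ Gshift d′ μ)
    IH d′ = W≗P⊛Gshift d′ la decreasing
    W0≗Gcap : W 0 la ≗ Gcap l μ
    W0≗Gcap = ≗-trans (IH 0) (≗-trans (one-⊛ (Gshift 0 μ)) (≗-sym (Gcap-uncapped l μ l≥la)))
    factor : ∀ P K C Q → ((P ⊛ K) ⊕ negPS (Q ⊛ (P ⊛ C))) ≗ (P ⊛ (K ⊕ negPS (Q ⊛ C)))
    factor = solve 4 (λ P K C Q → ((P :* K) :+ (:- (Q :* (P :* C)))) := (P :* (K :+ (:- (Q :* C))))) ≗-refl
    factor′ : ∀ P G K E → ((P ⊛ G) ⊛ (K ⊕ negPS (E ⊛ K))) ≗ (P ⊛ ((G ⊕ negPS (E ⊛ G)) ⊛ K))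
    factor′ = solve 4 (λ P G K E → ((P :* G) :* (K :+ (:- (E :* K)))) := (P :* ((G :+ (:- (E :* G))) :* K))) ≗-refl

  partition⇒weaklyDecreasing : ∀ {b} (la : Vec ℕ b) →
    (∀ (i j : Fin b) → i Fin.≤ j → Vec.lookup la j ℕ.≤ Vec.lookup la i) → WeaklyDecreasing (toList la)
  partition⇒weaklyDecreasing Vec.[]                 h = tt
  partition⇒weaklyDecreasing (l Vec.∷ Vec.[])       h = tt , tt
  partition⇒weaklyDecreasing (l Vec.∷ l′ Vec.∷ la) h =
    h Fin.zero (Fin.suc Fin.zero) z≤n , partition⇒weaklyDecreasing (l′ Vec.∷ la) (λ i j i≤j → h (Fin.suc i) (Fin.suc j) (s≤s i≤j))

open import Data.Product using (_,_)
open import Data.Vec using (toList)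
open import Relation.Binary.PropositionalEquality using (sym)
open Relation.Binary.PropositionalEquality.≡-Reasoning
open PowerSeriesAlgebra using (one-⊛)
open SubPartitionSeries using (Gshift)
open SubPartitions using (G≗Gshift)
open ShiftedRightHandSide using (P; W; W≗P⊛Gshift; RHS≗W; partition⇒weaklyDecreasing)

mainTheorem5 : (b : ℕ) → 1 ≤ b → (la : Vec ℕ b) → IsPartition la →
    (n : ℕ) → G la n ≡ RHS la n
mainTheorem5 b _ la (decreasing , _) n = begin
  G la n                                   ≡⟨ G≗Gshift la n ⟩
  Gshift 0 (toList la) n                   ≡⟨ sym (one-⊛ (Gshift 0 (toList la)) n) ⟩
  (P 0 ⊛ Gshift 0 (toList la)) n           ≡⟨ sym (W≗P⊛Gshift 0 la (partition⇒weaklyDecreasing la decreasing) n) ⟩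
  W 0 la n                                 ≡⟨ sym (RHS≗W la n) ⟩
  RHS la n                                 ∎
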